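{- Let $Q(x,y,z,w)=x^2+2y^2+7z^2+13w^2$, let $m$ be a positive integer, and let $k\in\mathbb{N}\cup\{0\}$. Then: $$\beta_2(m)=\begin{cases}\frac34\sum_{i=0}^{k-1}\frac{1}{2^{2i}}+\frac{1}{2^{2k}}\cdot\frac34 & \text{if } \operatorname{ord}_2(m)=2k,\ m/2^{2k}\equiv 1,3 \pmod 8,\\ \frac34\sum_{i=0}^{k-1}\frac{1}{2^{2i}}+\frac{1}{2^{2k}}\cdot\frac54 & \text{if } \operatorname{ord}_2(m)=2k,\ m/2^{2k}\equiv 5,7 \pmod 8,\\ \frac34\sum_{i=0}^{k}\frac{1}{2^{2i}}+\frac{1}{2^{2k+1}}\cdot\frac34 & \text{if } \operatorname{ord}_2(m)=2k+1,\ m/2^{2k+1}\equiv 1,3 \pmod 8,\\ \frac34\sum_{i=0}^{k}\frac{1}{2^{2i}}+\frac{1}{2^{2k+1}}\cdot\frac14 & \text{if } \operatorname{ord}_2(m)=2k+1,\ m/2^{2k+1}\equiv 5,7 \pmod 8;\end{cases}$$ $$\beta_7(m)=\begin{cases}\frac{48}{49}\sum_{i=0}^{k-1}\frac{1}{7^{2i}}+\frac{1}{7^{2k}}\cdot\frac87 & \text{if } \operatorname{ord}_7(m)=2k,\ m/7^{2k}\equiv 1,2,4 \pmod 7,\\ \frac{48}{49}\sum_{i=0}^{k-1}\frac{1}{7^{2i}}+\frac{1}{7^{2k}}\cdot\frac67 & \text{if } \operatorname{ord}_7(m)=2k,\ m/7^{2k}\equiv 3,5,6 \pmod 7,\\ \frac{48}{49}\sum_{i=0}^{k}\frac{1}{7^{2i}}+\frac{1}{7^{2k+1}}\cdot\frac27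 & \text{if } \operatorname{ord}_7(m)=2k+1,\ m/7^{2k+1}\equiv 1,2,4 \pmod 7,\\ \frac{48}{49}\sum_{i=0}^{k}\frac{1}{7^{2i}} & \text{if } \operatorname{ord}_7(m)=2k+1,\ m/7^{2k+1}\equiv 3,5,6 \pmod 7;\end{cases}$$ $$\beta_{13}(m)=\begin{cases}\frac{168}{169}\sum_{i=0}^{k-1}\frac{1}{13^{2i}}+\frac{1}{13^{2k}}\cdot\frac{14}{13} & \text{if } \operatorname{ord}_{13}(m)=2k,\ m/13^{2k}\equiv 1,3,4,9,10,12 \pmod{13},\\ \frac{168}{169}\sum_{i=0}^{k-1}\frac{1}{13^{2i}}+\frac{1}{13^{2k}}\cdot\frac{12}{13} & \text{if } \operatorname{ord}_{13}(m)=2k,\ m/13^{2k}\equiv 2,5,6,7,8,11 \pmod{13},\\ \frac{168}{169}\sum_{i=0}^{k}\frac{1}{13^{2i}}+\frac{1}{13^{2k+1}}\cdot\frac{2}{13} & \text{if } \operatorname{ord}_{13}(m)=2k+1,\ m/13^{2k+1}\equiv 1,3,4,9,10,12 \pmod{13},\\ \frac{168}{169}\sum_{i=0}^{k}\frac{1}{13^{2i}} & \text{if } \operatorname{ord}_{13}(m)=2k+1,\ m/13^{2k+1}\equiv 2,5,6,7,8,11 \pmod{13}.\end{cases}$$ (Empty sums are $0$.)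
   Context: For a quaternary integral quadratic form $Q$, a prime $p$ and a positive integer $m$, the local density is $$\beta_p(m)=\lim_{v\to\infty}\frac{\#\{\vec x\in(\mathbb{Z}/p^v\mathbb{Z})^4 : Q(\vec x)\equiv m \pmod{p^v}\}}{p^{3v}}.$$ $\operatorname{ord}_p(m)$ denotes the exponent of $p$ in $m$. -}

module Defs where

open import Data.Nat using (ℕ; zero; suc; _+_; _*_; _^_; _≤_; NonZero; _%_; _≡ᵇ_)
open import Data.Nat.Properties using (m^n≢0)
open import Data.Bool using (if_then_else_)
open import Data.Integer using (+_)
open import Data.Rational using (ℚ; _/_; 0ℚ; ∣_∣; _-_; _<_)
import Data.Rational as ℚ
open import Data.Product using (∃)

Q : ℕ → ℕ → ℕ → ℕ → ℕ
Q x y z w = x * x + 2 * (y * y) + 7 * (z * z) + 13 * (w * w)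

sumBelow : ℕ → (ℕ → ℕ) → ℕ
sumBelow zero    f = 0
sumBelow (suc n) f = sumBelow n f + f n

count : (N m : ℕ) → .{{_ : NonZero N}} → ℕ
count N m = sumBelow N λ x → sumBelow N λ y → sumBelow N λ z → sumBelow N λ w →
  if (Q x y z w % N) ≡ᵇ (m % N) then 1 else 0

inv : (p e : ℕ) → .{{_ : NonZero p}} → ℚ
inv p e = (+ 1 / (p ^ e)) {{m^n≢0 p e}}

ratio : (p m v : ℕ) → .{{_ : NonZero p}} → ℚ
ratio p m v = (+ count (p ^ v) m {{m^n≢0 p v}} / 1) ℚ.* inv p (3 * v)

IsLocalDensity : (p m : ℕ) → .{{_ : NonZero p}} → ℚ → Set
IsLocalDensity p m L =
  ∀ (ε : ℚ) → 0ℚ < ε → ∃ λ (N : ℕ) → ∀ (v : ℕ) → N ≤ v → ∣ ratio p m v - L ∣ < ε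

geom : (p k : ℕ) → .{{_ : NonZero p}} → ℚ
geom p zero    = 0ℚ
geom p (suc k) = geom p k ℚ.+ inv p (2 * k)

-- Split the solutions of Q ≡ m (mod pᵛ) into regular ones, where a coordinate whose coefficient is a
-- p-adic unit is itself a unit, and singular ones. Regular solutions lift like a smooth variety: each
-- has exactly p³ lifts to the next level (for p = 2 this holds from level 3 on, a lift to 2ᵛ⁺¹ being
-- decided by the point modulo 2ᵛ⁻¹). Singular solutions reduce to smaller problems: there are none
-- when p ∤ m; when m = p u they are the solutions of a rescaled form F′ ≡ u, all regular in z; when
-- m = p² M they are p times the solutions of Q ≡ M two levels down, so β_p(p² M) = γ + p⁻² β_p(M)
-- with γ the density of the regular solutions of Q ≡ 0. Hence the ratio defining β_p(m) is eventually
-- constant, and all the constants are finite counts modulo p (modulo 8 for p = 2).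
module Submission where

open import Defs
open import Data.Nat hiding (_/_)
open import Data.Nat.Properties
open import Data.Nat.DivMod hiding (_/_; _mod_)
open import Data.Nat.Divisibility
  using (_∣_; divides; n∣m*n; m∣m*n; ∣m∣n⇒∣m+n; ∣n⇒∣m*n; ∣m⇒∣m*n; m%n≡0⇒n∣m; n∣m⇒m%n≡0)
open import Data.Nat.Solver using (module +-*-Solver)
open import Data.Bool using (Bool; true; false; if_then_else_; T; _∧_; _∨_; not)
open import Data.Bool.Properties using (T-∧)
open import Data.Unit using (tt)
open import Data.Empty using (⊥-elim)
open import Data.Product using (_×_; _,_; proj₁; proj₂)
open import Data.Sum using (_⊎_; inj₁; inj₂)
open import Function.Bundles using (Equivalence)
open import Relation.Nullary using (¬_; yes; no)
open import Relation.Binary.PropositionalEquality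
open import Data.Integer using (+_)
import Data.Integer as ℤ
import Data.Integer.Properties as ℤP
open import Data.Rational using (ℚ; _/_)
import Data.Rational as ℚ
import Data.Rational.Properties as ℚP
open import Data.Rational.Unnormalised using (mkℚᵘ; *≡*)
import Data.Rational.Unnormalised.Properties as ℚᵘP

open +-*-Solver

ind : Bool → ℕ
ind b = if b then 1 else 0

sumBelow-cong : ∀ n {f g : ℕ → ℕ} → (∀ i → i < n → f i ≡ g i) → sumBelow n f ≡ sumBelow n g
sumBelow-cong zero    h = refl
sumBelow-cong (suc n) h = cong₂ _+_ (sumBelow-cong n (λ i i<n → h i (m<n⇒m<1+n i<n))) (h n ≤-refl)

sumBelow-+ : ∀ n (f g : ℕ → ℕ) → sumBelow n (λ i → f i + g i) ≡ sumBelow n f + sumBelow n g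
sumBelow-+ zero    f g = refl
sumBelow-+ (suc n) f g rewrite sumBelow-+ n f g =
  solve 4 (λ a b c d → a :+ b :+ (c :+ d) := a :+ c :+ (b :+ d)) refl (sumBelow n f) (sumBelow n g) (f n) (g n)

sumBelow-* : ∀ n c (f : ℕ → ℕ) → sumBelow n (λ i → c * f i) ≡ c * sumBelow n f
sumBelow-* zero    c f = sym (*-zeroʳ c)
sumBelow-* (suc n) c f rewrite sumBelow-* n c f = sym (*-distribˡ-+ c (sumBelow n f) (f n))

sumBelow-const : ∀ n c → sumBelow n (λ _ → c) ≡ n * c
sumBelow-const zero    c = refl
sumBelow-const (suc n) c rewrite sumBelow-const n c = +-comm (n * c) c

sumBelow-zeros : ∀ n (f : ℕ → ℕ) → (∀ i → i < n → f i ≡ 0) → sumBelow n f ≡ 0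
sumBelow-zeros n f h = trans (sumBelow-cong n h) (trans (sumBelow-const n 0) (*-zeroʳ n))

sumBelow-swap : ∀ n k (f : ℕ → ℕ → ℕ) →
  sumBelow n (λ i → sumBelow k (λ j → f i j)) ≡ sumBelow k (λ j → sumBelow n (λ i → f i j))
sumBelow-swap zero    k f = sym (sumBelow-zeros k _ λ _ _ → refl)
sumBelow-swap (suc n) k f rewrite sumBelow-swap n k f =
  sym (sumBelow-+ k (λ j → sumBelow n (λ i → f i j)) (λ j → f n j))

sumBelow-split : ∀ a b (f : ℕ → ℕ) → sumBelow (a + b) f ≡ sumBelow a f + sumBelow b (λ i → f (a + i))
sumBelow-split a zero    f rewrite +-identityʳ a = sym (+-identityʳ _)
sumBelow-split a (suc b) f rewrite +-suc a b | sumBelow-split a b f = +-assoc (sumBelow a f) _ _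

sumBelow-blocks : ∀ K S (f : ℕ → ℕ) →
  sumBelow (K * S) f ≡ sumBelow S (λ x → sumBelow K (λ t → f (x + t * S)))
sumBelow-blocks zero    S f = sym (sumBelow-zeros S _ λ _ _ → refl)
sumBelow-blocks (suc K) S f = begin
  sumBelow (S + K * S) f
    ≡⟨ cong (λ n → sumBelow n f) (+-comm S (K * S)) ⟩
  sumBelow (K * S + S) f
    ≡⟨ sumBelow-split (K * S) S f ⟩
  sumBelow (K * S) f + sumBelow S (λ i → f (K * S + i))
    ≡⟨ cong₂ _+_ (sumBelow-blocks K S f) (sumBelow-cong S (λ i _ → cong f (+-comm (K * S) i))) ⟩
  sumBelow S (λ x → sumBelow K (λ t → f (x + t * S))) + sumBelow S (λ x → f (x + K * S))
    ≡⟨ sym (sumBelow-+ S _ _) ⟩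
  sumBelow S (λ x → sumBelow (suc K) (λ t → f (x + t * S))) ∎
  where open ≡-Reasoning

sumBelow-periodic : ∀ K S (g : ℕ → ℕ) → (∀ z t → g (z + t * S) ≡ g z) → sumBelow (K * S) g ≡ K * sumBelow S g
sumBelow-periodic K S g h =
  trans (sumBelow-blocks K S g)
        (trans (sumBelow-cong S λ z _ → trans (sumBelow-cong K λ t _ → h z t) (sumBelow-const K (g z)))
               (sumBelow-* S K g))

sumBelow-only-0 : ∀ n (f : ℕ → ℕ) → 0 < n → (∀ i → 0 < i → i < n → f i ≡ 0) → sumBelow n f ≡ f 0
sumBelow-only-0 (suc zero)    f _ h = refl
sumBelow-only-0 (suc (suc n)) f _ h
  rewrite sumBelow-only-0 (suc n) f (s≤s z≤n) (λ i p q → h i p (m<n⇒m<1+n q))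
        | h (suc n) (s≤s z≤n) ≤-refl = +-identityʳ (f 0)

Fun4 : Set
Fun4 = ℕ → ℕ → ℕ → ℕ → ℕ

Pred4 : Set
Pred4 = ℕ → ℕ → ℕ → ℕ → Bool

Σ4 : ℕ → Fun4 → ℕ
Σ4 N f = sumBelow N λ x → sumBelow N λ y → sumBelow N λ z → sumBelow N λ w → f x y z w

Σ4-cong : ∀ N {f g : Fun4} →
  (∀ x y z w → x < N → y < N → z < N → w < N → f x y z w ≡ g x y z w) → Σ4 N f ≡ Σ4 N g
Σ4-cong N h =
  sumBelow-cong N λ x hx → sumBelow-cong N λ y hy → sumBelow-cong N λ z hz → sumBelow-cong N λ w hw →
  h x y z w hx hy hz hw

Σ4-+ : ∀ N (f g : Fun4) → Σ4 N (λ x y z w → f x y z w + g x y z w) ≡ Σ4 N f + Σ4 N g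
Σ4-+ N f g =
  trans (sumBelow-cong N λ x _ → trans (sumBelow-cong N λ y _ → trans (sumBelow-cong N λ z _ →
    sumBelow-+ N _ _) (sumBelow-+ N _ _)) (sumBelow-+ N _ _)) (sumBelow-+ N _ _)

Σ4-* : ∀ N c (f : Fun4) → Σ4 N (λ x y z w → c * f x y z w) ≡ c * Σ4 N f
Σ4-* N c f =
  trans (sumBelow-cong N λ x _ → trans (sumBelow-cong N λ y _ → trans (sumBelow-cong N λ z _ →
    sumBelow-* N c _) (sumBelow-* N c _)) (sumBelow-* N c _)) (sumBelow-* N c _)

Σ4-const : ∀ N c → Σ4 N (λ _ _ _ _ → c) ≡ N * (N * (N * (N * c)))
Σ4-const N c =
  trans (sumBelow-cong N λ x _ → trans (sumBelow-cong N λ y _ → trans (sumBelow-cong N λ z _ →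
    sumBelow-const N c) (sumBelow-const N _)) (sumBelow-const N _)) (sumBelow-const N _)

Σ4-zero : ∀ N → Σ4 N (λ _ _ _ _ → 0) ≡ 0
Σ4-zero N = Σ4-* N 0 (λ _ _ _ _ → 0)

Σ3-const : ∀ K e (f : ℕ → ℕ → ℕ → ℕ) → (∀ t s r → f t s r ≡ e) →
  (sumBelow K λ t → sumBelow K λ s → sumBelow K λ r → f t s r) ≡ K * (K * (K * e))
Σ3-const K e f h =
  trans (sumBelow-cong K λ t _ → trans (sumBelow-cong K λ s _ → trans (sumBelow-cong K λ r _ → h t s r)
    (sumBelow-const K e)) (sumBelow-const K _)) (sumBelow-const K _)

Σ4-blocks : ∀ K S (f : Fun4) →
  Σ4 (K * S) f ≡ Σ4 S (λ x y z w → Σ4 K (λ t s r q → f (x + t * S) (y + s * S) (z + r * S) (w + q * S)))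
Σ4-blocks K S f = trans blocks (sumBelow-cong S λ x _ → trans (out-y x)
                    (sumBelow-cong S λ y _ → trans (out-z x y) (sumBelow-cong S λ z _ → out-w x y z)))
  where
  g : ∀ x y z w t s r q → ℕ
  g x y z w t s r q = f (x + t * S) (y + s * S) (z + r * S) (w + q * S)
  blocks : Σ4 (K * S) f ≡ sumBelow S λ x → sumBelow K λ t → sumBelow S λ y → sumBelow K λ s →
                          sumBelow S λ z → sumBelow K λ r → sumBelow S λ w → sumBelow K λ q → g x y z w t s r q
  blocks = trans (sumBelow-blocks K S _) (sumBelow-cong S λ x _ → sumBelow-cong K λ t _ →
           trans (sumBelow-blocks K S _) (sumBelow-cong S λ y _ → sumBelow-cong K λ s _ →
           trans (sumBelow-blocks K S _) (sumBelow-cong S λ z _ → sumBelow-cong K λ r _ →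
           sumBelow-blocks K S _)))
  out-y : ∀ x → (sumBelow K λ t → sumBelow S λ y → sumBelow K λ s →
                 sumBelow S λ z → sumBelow K λ r → sumBelow S λ w → sumBelow K λ q → g x y z w t s r q)
              ≡ (sumBelow S λ y → sumBelow K λ t → sumBelow K λ s →
                 sumBelow S λ z → sumBelow K λ r → sumBelow S λ w → sumBelow K λ q → g x y z w t s r q)
  out-y x = sumBelow-swap K S _
  out-z : ∀ x y → (sumBelow K λ t → sumBelow K λ s →
                   sumBelow S λ z → sumBelow K λ r → sumBelow S λ w → sumBelow K λ q → g x y z w t s r q)
                ≡ (sumBelow S λ z → sumBelow K λ t → sumBelow K λ s →
                   sumBelow K λ r → sumBelow S λ w → sumBelow K λ q → g x y z w t s r q)
  out-z x y = trans (sumBelow-cong K λ t _ → sumBelow-swap K S _) (sumBelow-swap K S _)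
  out-w : ∀ x y z → (sumBelow K λ t → sumBelow K λ s →
                     sumBelow K λ r → sumBelow S λ w → sumBelow K λ q → g x y z w t s r q)
                  ≡ (sumBelow S λ w → sumBelow K λ t → sumBelow K λ s →
                     sumBelow K λ r → sumBelow K λ q → g x y z w t s r q)
  out-w x y z = trans (sumBelow-cong K λ t _ → trans (sumBelow-cong K λ s _ → sumBelow-swap K S _)
                                                     (sumBelow-swap K S _))
                      (sumBelow-swap K S _)

Σ4-periodic : ∀ K S (f : Fun4) →
  (∀ x y z w t s r q → f (x + t * S) (y + s * S) (z + r * S) (w + q * S) ≡ f x y z w) →
  Σ4 (K * S) f ≡ K * (K * (K * (K * 1))) * Σ4 S f
Σ4-periodic K S f h =
  trans (Σ4-blocks K S f)
  (trans (Σ4-cong S λ x y z w _ _ _ _ →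
           trans (Σ4-cong K λ t s r q _ _ _ _ → h x y z w t s r q)
                 (trans (Σ4-const K (f x y z w))
                        (solve 2 (λ K X → K :* (K :* (K :* (K :* X))) := K :* (K :* (K :* (K :* con 1))) :* X)
                               refl K (f x y z w))))
         (Σ4-* S (K * (K * (K * (K * 1)))) f))

≡ᵇ-true : ∀ a b → a ≡ b → (a ≡ᵇ b) ≡ true
≡ᵇ-true a b e with a ≡ᵇ b | ≡⇒≡ᵇ a b e
... | true | _ = refl

≡ᵇ-false : ∀ a b → a ≢ b → (a ≡ᵇ b) ≡ false
≡ᵇ-false a b ne with a ≡ᵇ b | ≡ᵇ⇒≡ a b
... | true  | f = ⊥-elim (ne (f tt))
... | false | _ = refl

ind-≡ : ∀ a b → a ≡ b → ind (a ≡ᵇ b) ≡ 1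
ind-≡ a b e = cong ind (≡ᵇ-true a b e)

ind-≢ : ∀ a b → a ≢ b → ind (a ≡ᵇ b) ≡ 0
ind-≢ a b ne = cong ind (≡ᵇ-false a b ne)

ind-cong : ∀ {a b c d} → (a ≡ b → c ≡ d) → (c ≡ d → a ≡ b) → ind (a ≡ᵇ b) ≡ ind (c ≡ᵇ d)
ind-cong {a} {b} {c} {d} f g with a ≟ b
... | yes e  = trans (ind-≡ a b e) (sym (ind-≡ c d (f e)))
... | no  ne = trans (ind-≢ a b ne) (sym (ind-≢ c d (λ e → ne (g e))))

ind-not : ∀ b → ind (not b) + ind b ≡ 1
ind-not true  = refl
ind-not false = refl

ind-∧ : ∀ a b c → ind (a ∧ b ∧ c) ≡ ind a * (ind b * ind c)
ind-∧ true  true  true  = refl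
ind-∧ true  true  false = refl
ind-∧ true  false c     = refl
ind-∧ false b     c     = refl

digits-unique : ∀ {a b c d D} .{{_ : NonZero D}} →
  a < D → c < D → a + b * D ≡ c + d * D → a ≡ c × b ≡ d
digits-unique {a} {b} {c} {d} {D} a<D c<D eq =
  a≡c , *-cancelʳ-≡ b d D (+-cancelˡ-≡ a _ _ (trans eq (cong (_+ d * D) (sym a≡c))))
  where
  a≡c : a ≡ c
  a≡c = begin
    a              ≡⟨ sym (m<n⇒m%n≡m a<D) ⟩
    a % D          ≡⟨ sym ([m+kn]%n≡m%n a b D) ⟩
    (a + b * D) % D ≡⟨ cong (_% D) eq ⟩
    (c + d * D) % D ≡⟨ [m+kn]%n≡m%n c d D ⟩
    c % D          ≡⟨ m<n⇒m%n≡m c<D ⟩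
    c              ∎
    where open ≡-Reasoning

ind-digits : ∀ {X₁ Y₁ X₂ Y₂ D} .{{_ : NonZero D}} → X₁ < D → X₂ < D →
  ind (X₁ + Y₁ * D ≡ᵇ X₂ + Y₂ * D) ≡ ind (X₁ ≡ᵇ X₂) * ind (Y₁ ≡ᵇ Y₂)
ind-digits {X₁} {Y₁} {X₂} {Y₂} {D} h₁ h₂ with X₁ ≟ X₂ | Y₁ ≟ Y₂
... | yes e₁ | yes e₂ rewrite ind-≡ X₁ X₂ e₁ | ind-≡ Y₁ Y₂ e₂ =
  ind-≡ _ _ (cong₂ (λ u v → u + v * D) e₁ e₂)
... | no n₁ | _ rewrite ind-≢ X₁ X₂ n₁ =
  ind-≢ (X₁ + Y₁ * D) (X₂ + Y₂ * D) (λ e → n₁ (proj₁ (digits-unique {X₁} {Y₁} {X₂} {Y₂} {D} h₁ h₂ e)))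
... | yes e₁ | no n₂ rewrite ind-≢ Y₁ Y₂ n₂ | *-zeroʳ (ind (X₁ ≡ᵇ X₂)) =
  ind-≢ (X₁ + Y₁ * D) (X₂ + Y₂ * D) (λ e → n₂ (proj₂ (digits-unique {X₁} {Y₁} {X₂} {Y₂} {D} h₁ h₂ e)))

%-*-digit : ∀ x p D .{{_ : NonZero p}} .{{_ : NonZero D}} {{nzpD : NonZero (p * D)}} →
  x % (p * D) ≡ x % D + (x div D % p) * D
%-*-digit x p D {{_}} {{_}} {{nzpD}} = begin
  x % (p * D)
    ≡⟨ m≡m%n+[m/n]*n (x % (p * D)) D ⟩
  x % (p * D) % D + x % (p * D) div D * D
    ≡⟨ cong₂ (λ u v → u + v * D) (m∣n⇒o%n%m≡o%m D (p * D) x {{_}} {{nzpD}} (n∣m*n p {D})) (m%[n*o]/o≡m/o%n x p D) ⟩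
  x % D + (x div D % p) * D ∎
  where open ≡-Reasoning

ind-%-* : ∀ A L m p D .{{_ : NonZero p}} .{{_ : NonZero D}} {{_ : NonZero (p * D)}} →
  ind ((A + L * D) % (p * D) ≡ᵇ m % (p * D)) ≡ ind (A % D ≡ᵇ m % D) * ind ((A div D + L) % p ≡ᵇ m div D % p)
ind-%-* A L m p D = begin
  ind ((A + L * D) % (p * D) ≡ᵇ m % (p * D))
    ≡⟨ cong₂ (λ u v → ind (u ≡ᵇ v)) (%-*-digit (A + L * D) p D) (%-*-digit m p D) ⟩
  ind ((A + L * D) % D + ((A + L * D) div D % p) * D ≡ᵇ m % D + (m div D % p) * D)
    ≡⟨ cong₂ (λ u v → ind (u + (v % p) * D ≡ᵇ m % D + (m div D % p) * D)) ([m+kn]%n≡m%n A L D) shift ⟩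
  ind (A % D + ((A div D + L) % p) * D ≡ᵇ m % D + (m div D % p) * D)
    ≡⟨ ind-digits {A % D} {(A div D + L) % p} {m % D} {m div D % p} {D} (m%n<n A D) (m%n<n m D) ⟩
  ind (A % D ≡ᵇ m % D) * ind ((A div D + L) % p ≡ᵇ m div D % p) ∎
  where
  open ≡-Reasoning
  shift : (A + L * D) div D ≡ A div D + L
  shift = trans (+-distrib-/-∣ʳ A (n∣m*n L)) (cong (_+_ (A div D)) (m*n/n≡m L D))

LineHits : (p K e c γ : ℕ) → .{{NonZero p}} → Set
LineHits p K e c γ = ∀ B → sumBelow K (λ t → ind ((B + c * t) % p ≡ᵇ γ)) ≡ e

Σ4-line-hits : ∀ p K e c₁ c₂ c₃ c₄ γ .{{_ : NonZero p}} →
  (LineHits p K e c₁ γ ⊎ LineHits p K e c₂ γ ⊎ LineHits p K e c₃ γ ⊎ LineHits p K e c₄ γ) →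
  ∀ B → Σ4 K (λ t s r q → ind ((B + (c₁ * t + c₂ * s + c₃ * r + c₄ * q)) % p ≡ᵇ γ)) ≡ K * (K * (K * e))
Σ4-line-hits p K e c₁ c₂ c₃ c₄ γ (inj₂ (inj₂ (inj₂ h))) B =
  Σ3-const K e _ λ t s r → trans (sumBelow-cong K λ q _ → cong (λ x → ind (x % p ≡ᵇ γ))
    (solve 9 (λ B c₁ c₂ c₃ c₄ t s r q → B :+ (c₁ :* t :+ c₂ :* s :+ c₃ :* r :+ c₄ :* q)
                                     := (B :+ (c₁ :* t :+ c₂ :* s :+ c₃ :* r)) :+ c₄ :* q) refl B c₁ c₂ c₃ c₄ t s r q))
    (h _)
Σ4-line-hits p K e c₁ c₂ c₃ c₄ γ (inj₂ (inj₂ (inj₁ h))) B =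
  trans (sumBelow-cong K λ t _ → sumBelow-cong K λ s _ → sumBelow-swap K K _)
  (Σ3-const K e _ λ t s q → trans (sumBelow-cong K λ r _ → cong (λ x → ind (x % p ≡ᵇ γ))
    (solve 9 (λ B c₁ c₂ c₃ c₄ t s r q → B :+ (c₁ :* t :+ c₂ :* s :+ c₃ :* r :+ c₄ :* q)
                                     := (B :+ (c₁ :* t :+ c₂ :* s :+ c₄ :* q)) :+ c₃ :* r) refl B c₁ c₂ c₃ c₄ t s r q))
    (h _))
Σ4-line-hits p K e c₁ c₂ c₃ c₄ γ (inj₂ (inj₁ h)) B =
  trans (sumBelow-cong K λ t _ → trans (sumBelow-swap K K _) (sumBelow-cong K λ r _ → sumBelow-swap K K _))
  (Σ3-const K e _ λ t r q → trans (sumBelow-cong K λ s _ → cong (λ x → ind (x % p ≡ᵇ γ))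
    (solve 9 (λ B c₁ c₂ c₃ c₄ t s r q → B :+ (c₁ :* t :+ c₂ :* s :+ c₃ :* r :+ c₄ :* q)
                                     := (B :+ (c₁ :* t :+ c₃ :* r :+ c₄ :* q)) :+ c₂ :* s) refl B c₁ c₂ c₃ c₄ t s r q))
    (h _))
Σ4-line-hits p K e c₁ c₂ c₃ c₄ γ (inj₁ h) B =
  trans (trans (sumBelow-swap K K _) (sumBelow-cong K λ s _ → trans (sumBelow-swap K K _)
                                                                     (sumBelow-cong K λ r _ → sumBelow-swap K K _)))
  (Σ3-const K e _ λ s r q → trans (sumBelow-cong K λ t _ → cong (λ x → ind (x % p ≡ᵇ γ))
    (solve 9 (λ B c₁ c₂ c₃ c₄ t s r q → B :+ (c₁ :* t :+ c₂ :* s :+ c₃ :* r :+ c₄ :* q)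
                                     := (B :+ (c₂ :* s :+ c₃ :* r :+ c₄ :* q)) :+ c₁ :* t) refl B c₁ c₂ c₃ c₄ t s r q))
    (h _))

solutions : (N r : ℕ) (g : Pred4) (F : Fun4) → .{{NonZero N}} → ℕ
solutions N r g F = Σ4 N (λ x y z w → ind (g x y z w) * ind (F x y z w % N ≡ᵇ r))

-- The fibre over one point A of the lower level: as (t,s,r,q) runs over K⁴, H is A plus a linear
-- form times D, up to multiples of p D, so the next digit is counted by Σ4-line-hits.
lift-fibre : ∀ p K e D A m c₁ c₂ c₃ c₄ (H R : Fun4) (gv : Bool) (G : Pred4)
  .{{_ : NonZero p}} .{{_ : NonZero D}} {{_ : NonZero (p * D)}} →
  (∀ t s r q → G t s r q ≡ gv) →
  (∀ t s r q → H t s r q ≡ A + (c₁ * t + c₂ * s + c₃ * r + c₄ * q) * D + R t s r q * (p * D)) →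
  (T gv → LineHits p K e c₁ (m div D % p) ⊎ LineHits p K e c₂ (m div D % p)
        ⊎ LineHits p K e c₃ (m div D % p) ⊎ LineHits p K e c₄ (m div D % p)) →
  Σ4 K (λ t s r q → ind (G t s r q) * ind (H t s r q % (p * D) ≡ᵇ m % (p * D)))
    ≡ ind gv * (ind (A % D ≡ᵇ m % D) * (K * (K * (K * e))))
lift-fibre p K e D A m c₁ c₂ c₃ c₄ H R false G hG hH hU =
  trans (Σ4-cong K λ t s r q _ _ _ _ → cong (λ b → ind b * _) (hG t s r q)) (Σ4-zero K)
lift-fibre p K e D A m c₁ c₂ c₃ c₄ H R true G {{_}} {{_}} {{nz}} hG hH hU =
  trans (Σ4-cong K λ t s r q _ _ _ _ → term t s r q)
  (trans (Σ4-* K (ind (A % D ≡ᵇ m % D)) _)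
  (trans (cong (ind (A % D ≡ᵇ m % D) *_) (Σ4-line-hits p K e c₁ c₂ c₃ c₄ (m div D % p) (hU tt) (A div D)))
         (sym (+-identityʳ _))))
  where
  term : ∀ t s r q → ind (G t s r q) * ind (H t s r q % (p * D) ≡ᵇ m % (p * D))
       ≡ ind (A % D ≡ᵇ m % D) * ind ((A div D + (c₁ * t + c₂ * s + c₃ * r + c₄ * q)) % p ≡ᵇ m div D % p)
  term t s r q rewrite hG t s r q | hH t s r q
    | +-identityʳ (ind ((A + (c₁ * t + c₂ * s + c₃ * r + c₄ * q) * D + R t s r q * (p * D)) % (p * D) ≡ᵇ m % (p * D)))
    | [m+kn]%n≡m%n (A + (c₁ * t + c₂ * s + c₃ * r + c₄ * q) * D) (R t s r q) (p * D) {{nz}}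
    = ind-%-* A (c₁ * t + c₂ * s + c₃ * r + c₄ * q) m p D

-- Hensel lifting from modulus D to p D, the points being split into blocks of K⁴ lifts of one point mod S.
hensel-lift : ∀ p K e D S m (g : Pred4) (F : Fun4) (C₁ C₂ C₃ C₄ : Fun4) (R : ℕ → ℕ → ℕ → ℕ → Fun4)
  .{{_ : NonZero p}} .{{_ : NonZero D}} {{_ : NonZero (p * D)}} →
  (∀ x y z w t s r q → g (x + t * S) (y + s * S) (z + r * S) (w + q * S) ≡ g x y z w) →
  (∀ x y z w t s r q → F (x + t * S) (y + s * S) (z + r * S) (w + q * S)
       ≡ F x y z w + (C₁ x y z w * t + C₂ x y z w * s + C₃ x y z w * r + C₄ x y z w * q) * D
         + R x y z w t s r q * (p * D)) →
  (∀ x y z w → T (g x y z w) →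
     LineHits p K e (C₁ x y z w) (m div D % p) ⊎ LineHits p K e (C₂ x y z w) (m div D % p)
   ⊎ LineHits p K e (C₃ x y z w) (m div D % p) ⊎ LineHits p K e (C₄ x y z w) (m div D % p)) →
  Σ4 (K * S) (λ x y z w → ind (g x y z w) * ind (F x y z w % (p * D) ≡ᵇ m % (p * D)))
    ≡ Σ4 S (λ x y z w → ind (g x y z w) * (ind (F x y z w % D ≡ᵇ m % D) * (K * (K * (K * e)))))
hensel-lift p K e D S m g F C₁ C₂ C₃ C₄ R hg hF hU =
  trans (Σ4-blocks K S _) (Σ4-cong S λ x y z w _ _ _ _ →
    lift-fibre p K e D (F x y z w) m (C₁ x y z w) (C₂ x y z w) (C₃ x y z w) (C₄ x y z w)
      (λ t s r q → F (x + t * S) (y + s * S) (z + r * S) (w + q * S)) (R x y z w) (g x y z w)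
      (λ t s r q → g (x + t * S) (y + s * S) (z + r * S) (w + q * S))
      (hg x y z w) (hF x y z w) (hU x y z w))

diag : ℕ → ℕ → ℕ → ℕ → Fun4
diag a b c d x y z w = a * (x * x) + b * (y * y) + c * (z * z) + d * (w * w)

residue : ∀ p n → .{{NonZero p}} → ℕ → ℕ
residue p n m = (m % p ^ n) {{m^n≢0 p n}}

digit : ∀ p n → .{{NonZero p}} → ℕ → ℕ
digit p n m = (m div p ^ n) {{m^n≢0 p n}} % p

digit<p : ∀ p n m .{{_ : NonZero p}} → digit p n m < p
digit<p p n m = m%n<n _ p

solutions^ : ∀ p n → .{{NonZero p}} → ℕ → Pred4 → Fun4 → ℕ
solutions^ p n r g F = solutions (p ^ n) r g F {{m^n≢0 p n}}

diag-translate : ∀ a b c d x y z w t s r q S →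
  diag a b c d (x + t * S) (y + s * S) (z + r * S) (w + q * S)
  ≡ diag a b c d x y z w + (2 * a * x * t + 2 * b * y * s + 2 * c * z * r + 2 * d * w * q
                            + (a * (t * t) + b * (s * s) + c * (r * r) + d * (q * q)) * S) * S
diag-translate = solve 13 (λ a b c d x y z w t s r q S →
  a :* ((x :+ t :* S) :* (x :+ t :* S)) :+ b :* ((y :+ s :* S) :* (y :+ s :* S))
  :+ c :* ((z :+ r :* S) :* (z :+ r :* S)) :+ d :* ((w :+ q :* S) :* (w :+ q :* S))
  := a :* (x :* x) :+ b :* (y :* y) :+ c :* (z :* z) :+ d :* (w :* w)
     :+ (con 2 :* a :* x :* t :+ con 2 :* b :* y :* s :+ con 2 :* c :* z :* r :+ con 2 :* d :* w :* q
         :+ (a :* (t :* t) :+ b :* (s :* s) :+ c :* (r :* r) :+ d :* (q :* q)) :* S) :* S) refl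

diag-%-translate : ∀ a b c d S x y z w t s r q .{{_ : NonZero S}} →
  diag a b c d (x + t * S) (y + s * S) (z + r * S) (w + q * S) % S ≡ diag a b c d x y z w % S
diag-%-translate a b c d S x y z w t s r q =
  trans (cong (_% S) (diag-translate a b c d x y z w t s r q S))
        ([m+kn]%n≡m%n (diag a b c d x y z w)
                      (2 * a * x * t + 2 * b * y * s + 2 * c * z * r + 2 * d * w * q
                       + (a * (t * t) + b * (s * s) + c * (r * r) + d * (q * q)) * S) S)

-- Translating by p S′ changes diag by its gradient times p S′, up to a multiple of (p S′)² = p (p S′) S′.
diag-translate-p : ∀ a b c d x y z w t s r q p S′ →
  diag a b c d (x + t * (p * S′)) (y + s * (p * S′)) (z + r * (p * S′)) (w + q * (p * S′))
  ≡ diag a b c d x y z w + (2 * a * x * t + 2 * b * y * s + 2 * c * z * r + 2 * d * w * q) * (p * S′)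
    + ((a * (t * t) + b * (s * s) + c * (r * r) + d * (q * q)) * S′) * (p * (p * S′))
diag-translate-p = solve 14 (λ a b c d x y z w t s r q p S′ →
  a :* ((x :+ t :* (p :* S′)) :* (x :+ t :* (p :* S′))) :+ b :* ((y :+ s :* (p :* S′)) :* (y :+ s :* (p :* S′)))
  :+ c :* ((z :+ r :* (p :* S′)) :* (z :+ r :* (p :* S′))) :+ d :* ((w :+ q :* (p :* S′)) :* (w :+ q :* (p :* S′)))
  := a :* (x :* x) :+ b :* (y :* y) :+ c :* (z :* z) :+ d :* (w :* w)
     :+ (con 2 :* a :* x :* t :+ con 2 :* b :* y :* s :+ con 2 :* c :* z :* r :+ con 2 :* d :* w :* q) :* (p :* S′)
     :+ ((a :* (t :* t) :+ b :* (s :* s) :+ c :* (r :* r) :+ d :* (q :* q)) :* S′) :* (p :* (p :* S′))) refl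

-- For p = 2 the gradient is even, so a translation by 4 S′ only moves diag by (a x t + …) 8 S′.
diag-translate-4 : ∀ a b c d x y z w t s r q S′ →
  diag a b c d (x + t * (2 * (2 * S′))) (y + s * (2 * (2 * S′))) (z + r * (2 * (2 * S′))) (w + q * (2 * (2 * S′)))
  ≡ diag a b c d x y z w + (a * x * t + b * y * s + c * z * r + d * w * q) * (2 * (2 * (2 * S′)))
    + ((a * (t * t) + b * (s * s) + c * (r * r) + d * (q * q)) * S′) * (2 * (2 * (2 * (2 * S′))))
diag-translate-4 = solve 13 (λ a b c d x y z w t s r q S′ →
  a :* ((x :+ t :* (con 2 :* (con 2 :* S′))) :* (x :+ t :* (con 2 :* (con 2 :* S′))))
  :+ b :* ((y :+ s :* (con 2 :* (con 2 :* S′))) :* (y :+ s :* (con 2 :* (con 2 :* S′))))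
  :+ c :* ((z :+ r :* (con 2 :* (con 2 :* S′))) :* (z :+ r :* (con 2 :* (con 2 :* S′))))
  :+ d :* ((w :+ q :* (con 2 :* (con 2 :* S′))) :* (w :+ q :* (con 2 :* (con 2 :* S′))))
  := a :* (x :* x) :+ b :* (y :* y) :+ c :* (z :* z) :+ d :* (w :* w)
     :+ (a :* x :* t :+ b :* y :* s :+ c :* z :* r :+ d :* w :* q) :* (con 2 :* (con 2 :* (con 2 :* S′)))
     :+ ((a :* (t :* t) :+ b :* (s :* s) :+ c :* (r :* r) :+ d :* (q :* q)) :* S′)
        :* (con 2 :* (con 2 :* (con 2 :* (con 2 :* S′))))) refl

diag-translate-4′ : ∀ a b c d x y z w t s r q S′ →
  diag a b c d (x + t * (2 * (2 * S′))) (y + s * (2 * (2 * S′))) (z + r * (2 * (2 * S′))) (w + q * (2 * (2 * S′)))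
  ≡ diag a b c d x y z w + (a * x * t + b * y * s + c * z * r + d * w * q
                            + ((a * (t * t) + b * (s * s) + c * (r * r) + d * (q * q)) * S′) * 2) * (2 * (2 * (2 * S′)))
diag-translate-4′ = solve 13 (λ a b c d x y z w t s r q S′ →
  a :* ((x :+ t :* (con 2 :* (con 2 :* S′))) :* (x :+ t :* (con 2 :* (con 2 :* S′))))
  :+ b :* ((y :+ s :* (con 2 :* (con 2 :* S′))) :* (y :+ s :* (con 2 :* (con 2 :* S′))))
  :+ c :* ((z :+ r :* (con 2 :* (con 2 :* S′))) :* (z :+ r :* (con 2 :* (con 2 :* S′))))
  :+ d :* ((w :+ q :* (con 2 :* (con 2 :* S′))) :* (w :+ q :* (con 2 :* (con 2 :* S′))))
  := a :* (x :* x) :+ b :* (y :* y) :+ c :* (z :* z) :+ d :* (w :* w)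
     :+ (a :* x :* t :+ b :* y :* s :+ c :* z :* r :+ d :* w :* q
         :+ ((a :* (t :* t) :+ b :* (s :* s) :+ c :* (r :* r) :+ d :* (q :* q)) :* S′) :* con 2)
        :* (con 2 :* (con 2 :* (con 2 :* S′)))) refl

hensel-step-odd : ∀ p v a b c d m (g : Pred4) .{{_ : NonZero p}} →
  (∀ x y z w t s r q → g (x + t * p ^ suc v) (y + s * p ^ suc v) (z + r * p ^ suc v) (w + q * p ^ suc v) ≡ g x y z w) →
  (∀ x y z w → T (g x y z w) →
     LineHits p p 1 (2 * a * x) (digit p (suc v) m) ⊎ LineHits p p 1 (2 * b * y) (digit p (suc v) m)
   ⊎ LineHits p p 1 (2 * c * z) (digit p (suc v) m) ⊎ LineHits p p 1 (2 * d * w) (digit p (suc v) m)) →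
  solutions^ p (suc (suc v)) (residue p (suc (suc v)) m) g (diag a b c d)
    ≡ p * (p * (p * 1)) * solutions^ p (suc v) (residue p (suc v) m) g (diag a b c d)
hensel-step-odd p v a b c d m g hg hU =
  trans (hensel-lift p p 1 (p ^ suc v) (p ^ suc v) m g (diag a b c d)
          (λ x _ _ _ → 2 * a * x) (λ _ y _ _ → 2 * b * y) (λ _ _ z _ → 2 * c * z) (λ _ _ _ w → 2 * d * w)
          (λ _ _ _ _ t s r q → (a * (t * t) + b * (s * s) + c * (r * r) + d * (q * q)) * p ^ v)
          {{_}} {{m^n≢0 p (suc v)}} {{m^n≢0 p (suc (suc v))}}
          hg (λ x y z w t s r q → diag-translate-p a b c d x y z w t s r q p (p ^ v)) hU)
  (trans (Σ4-cong (p ^ suc v) λ x y z w _ _ _ _ →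
           solve 3 (λ u v E → u :* (v :* E) := E :* (u :* v)) refl (ind (g x y z w)) _ (p * (p * (p * 1))))
         (Σ4-* (p ^ suc v) (p * (p * (p * 1))) _))

-- For p = 2 a lift of the modulus by 2 is only controlled by a line modulo 2 after fixing
-- the point modulo 2^(j+2) rather than 2^(j+3): each of the 4 lifts of a coordinate is hit twice.
hensel-step-2 : ∀ j a b c d m (g : Pred4) →
  (∀ x y z w t s r q → g (x + t * 2 ^ (2 + j)) (y + s * 2 ^ (2 + j)) (z + r * 2 ^ (2 + j)) (w + q * 2 ^ (2 + j))
                       ≡ g x y z w) →
  (∀ x y z w → T (g x y z w) →
     LineHits 2 4 2 (a * x) (digit 2 (3 + j) m) ⊎ LineHits 2 4 2 (b * y) (digit 2 (3 + j) m)
   ⊎ LineHits 2 4 2 (c * z) (digit 2 (3 + j) m) ⊎ LineHits 2 4 2 (d * w) (digit 2 (3 + j) m)) →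
  solutions^ 2 (4 + j) (residue 2 (4 + j) m) g (diag a b c d) ≡ 8 * solutions^ 2 (3 + j) (residue 2 (3 + j) m) g (diag a b c d)
hensel-step-2 j a b c d m g hg hU =
  trans (cong (λ N → Σ4 N (λ x y z w → ind (g x y z w) * ind (residue 2 (4 + j) (F x y z w) ≡ᵇ residue 2 (4 + j) m)))
              (sym (*-assoc 2 2 S)))
  (trans (hensel-lift 2 4 2 D S m g F
            (λ x _ _ _ → a * x) (λ _ y _ _ → b * y) (λ _ _ z _ → c * z) (λ _ _ _ w → d * w)
            (λ _ _ _ _ t s r q → (a * (t * t) + b * (s * s) + c * (r * r) + d * (q * q)) * 2 ^ j)
            {{_}} {{m^n≢0 2 (3 + j)}} {{m^n≢0 2 (4 + j)}}
            hg (λ x y z w t s r q → diag-translate-4 a b c d x y z w t s r q (2 ^ j)) hU)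
  (trans (Σ4-cong S λ x y z w _ _ _ _ →
            solve 2 (λ u v → u :* (v :* (con 4 :* (con 4 :* (con 4 :* con 2)))) := con 8 :* (con 16 :* (u :* v)))
                  refl (ind (g x y z w)) (X x y z w))
  (trans (Σ4-* S 8 _)
         (cong (8 *_) (trans (Σ4-* S 16 f) (sym (Σ4-periodic 2 S f periodic)))))))
  where
  F = diag a b c d
  S = 2 ^ (2 + j)
  D = 2 ^ (3 + j)
  X : Fun4
  X x y z w = ind (residue 2 (3 + j) (F x y z w) ≡ᵇ residue 2 (3 + j) m)
  f : Fun4
  f x y z w = ind (g x y z w) * X x y z w
  periodic : ∀ x y z w t s r q → f (x + t * S) (y + s * S) (z + r * S) (w + q * S) ≡ f x y z w
  periodic x y z w t s r q =
    cong₂ (λ b u → ind b * ind (u ≡ᵇ residue 2 (3 + j) m)) (hg x y z w t s r q)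
      (trans (cong (residue 2 (3 + j)) (diag-translate-4′ a b c d x y z w t s r q (2 ^ j)))
             ([m+kn]%n≡m%n (F x y z w)
                           (a * x * t + b * y * s + c * z * r + d * w * q
                            + ((a * (t * t) + b * (s * s) + c * (r * r) + d * (q * q)) * 2 ^ j) * 2)
                           D {{m^n≢0 2 (3 + j)}}))

always : Pred4
always _ _ _ _ = true

-- For the forms below, whose z-coefficient alone is divisible by p.
singular : (p : ℕ) → .{{NonZero p}} → Pred4
singular p x y z w = (x % p ≡ᵇ 0) ∧ (y % p ≡ᵇ 0) ∧ (w % p ≡ᵇ 0)

regular : (p : ℕ) → .{{NonZero p}} → Pred4
regular p x y z w = not (singular p x y z w)

z-regular : (p : ℕ) → .{{NonZero p}} → Pred4
z-regular p x y z w = not (z % p ≡ᵇ 0)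

solutions-split : ∀ p v r F .{{_ : NonZero p}} →
  solutions^ p v r always F ≡ solutions^ p v r (regular p) F + solutions^ p v r (singular p) F
solutions-split p v r F = trans (Σ4-cong (p ^ v) λ x y z w _ _ _ _ → pointwise x y z w) (Σ4-+ (p ^ v) _ _)
  where
  X : Fun4
  X x y z w = ind ((F x y z w % p ^ v) {{m^n≢0 p v}} ≡ᵇ r)
  pointwise : ∀ x y z w → 1 * X x y z w ≡ ind (regular p x y z w) * X x y z w + ind (singular p x y z w) * X x y z w
  pointwise x y z w = trans (cong (_* X x y z w) (sym (ind-not (singular p x y z w))))
                            (*-distribʳ-+ (X x y z w) (ind (regular p x y z w)) (ind (singular p x y z w)))

%-translate : ∀ p S x t .{{_ : NonZero p}} → p ∣ S → (x + t * S) % p ≡ x % p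
%-translate p S x t h = %-remove-+ʳ x (∣n⇒∣m*n t h)

regular-translate : ∀ p S .{{_ : NonZero p}} → p ∣ S → ∀ x y z w t s r q →
  regular p (x + t * S) (y + s * S) (z + r * S) (w + q * S) ≡ regular p x y z w
regular-translate p S h x y z w t s r q rewrite %-translate p S x t h | %-translate p S y s h | %-translate p S w q h = refl

z-regular-translate : ∀ p S .{{_ : NonZero p}} → p ∣ S → ∀ x y z w t s r q →
  z-regular p (x + t * S) (y + s * S) (z + r * S) (w + q * S) ≡ z-regular p x y z w
z-regular-translate p S h x y z w t s r q rewrite %-translate p S z r h = refl

sumBelow-multiples : ∀ p v (h : ℕ → ℕ) .{{_ : NonZero p}} →
  sumBelow (p ^ suc v) (λ x → ind (x % p ≡ᵇ 0) * h x) ≡ sumBelow (p ^ v) (λ x → h (x * p))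
sumBelow-multiples p v h = begin
  sumBelow (p * p ^ v) f ≡⟨ cong (λ N → sumBelow N f) (*-comm p (p ^ v)) ⟩
  sumBelow (p ^ v * p) f ≡⟨ sumBelow-blocks (p ^ v) p f ⟩
  sumBelow p (λ i → sumBelow (p ^ v) (λ t → f (i + t * p))) ≡⟨ sumBelow-only-0 p _ (>-nonZero⁻¹ p) off-multiples ⟩
  sumBelow (p ^ v) (λ t → f (t * p)) ≡⟨ sumBelow-cong (p ^ v) (λ t _ → on-multiples t) ⟩
  sumBelow (p ^ v) (λ x → h (x * p)) ∎
  where
  open ≡-Reasoning
  f : ℕ → ℕ
  f x = ind (x % p ≡ᵇ 0) * h x
  off-multiples : ∀ i → 0 < i → i < p → sumBelow (p ^ v) (λ t → f (i + t * p)) ≡ 0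
  off-multiples i 0<i i<p = sumBelow-zeros (p ^ v) _ λ t _ → cong (_* h (i + t * p))
    (ind-≢ ((i + t * p) % p) 0 (λ e → <⇒≢ 0<i (sym (trans (sym (m<n⇒m%n≡m i<p)) (trans (sym ([m+kn]%n≡m%n i t p)) e)))))
  on-multiples : ∀ t → f (t * p) ≡ h (t * p)
  on-multiples t = trans (cong (λ u → ind (u ≡ᵇ 0) * h (t * p)) (m*n%n≡0 t p)) (+-identityʳ (h (t * p)))

singular-solutions : ∀ p v r (F : Fun4) .{{_ : NonZero p}} →
  solutions^ p (suc v) r (singular p) F ≡
    (sumBelow (p ^ v) λ x → sumBelow (p ^ v) λ y → sumBelow (p ^ suc v) λ z → sumBelow (p ^ v) λ w →
       ind ((F (x * p) (y * p) z (w * p) % p ^ suc v) {{m^n≢0 p (suc v)}} ≡ᵇ r))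
singular-solutions p v r F =
  trans (Σ4-cong N (λ x y z w _ _ _ _ → pointwise x y z w))
  (trans (sumBelow-cong N λ x _ → trans (sumBelow-cong N λ y _ → trans (sumBelow-cong N λ z _ →
            trans (sumBelow-* N (divisible x) _) (cong (divisible x *_) (sumBelow-* N (divisible y) _)))
          (trans (sumBelow-* N (divisible x) _) (cong (divisible x *_) (sumBelow-* N (divisible y) _))))
          (sumBelow-* N (divisible x) _))
  (trans (sumBelow-multiples p v _)
  (sumBelow-cong (p ^ v) λ x _ → trans (sumBelow-multiples p v _) (sumBelow-cong (p ^ v) λ y _ → sumBelow-cong N λ z _ → sumBelow-multiples p v _))))
  where
  N = p ^ suc v
  divisible : ℕ → ℕ
  divisible x = ind (x % p ≡ᵇ 0)
  X : Fun4
  X x y z w = ind ((F x y z w % N) {{m^n≢0 p (suc v)}} ≡ᵇ r)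
  pointwise : ∀ x y z w → ind (singular p x y z w) * X x y z w ≡ divisible x * (divisible y * (divisible w * X x y z w))
  pointwise x y z w rewrite ind-∧ (x % p ≡ᵇ 0) (y % p ≡ᵇ 0) (w % p ≡ᵇ 0) =
    trans (*-assoc (divisible x) _ _) (cong (divisible x *_) (*-assoc (divisible y) _ _))

ind-%-scale : ∀ k A B N .{{_ : NonZero k}} .{{_ : NonZero N}} {{_ : NonZero (N * k)}} →
  ind ((A * k) % (N * k) ≡ᵇ (B * k) % (N * k)) ≡ ind (A % N ≡ᵇ B % N)
ind-%-scale k A B N = trans (cong₂ (λ u v → ind (u ≡ᵇ v)) (sym (m%n*o≡m*o%[n*o] A N k)) (sym (m%n*o≡m*o%[n*o] B N k)))
  (ind-cong (*-cancelʳ-≡ (A % N) (B % N) k) (cong (_* k)))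

solutions-always : ∀ N r (F : Fun4) .{{_ : NonZero N}} → solutions N r always F ≡ Σ4 N (λ x y z w → ind (F x y z w % N ≡ᵇ r))
solutions-always N r F = Σ4-cong N λ x y z w _ _ _ _ → +-identityʳ _

diag-singular-divisible : ∀ p a b c′ d x y z w .{{_ : NonZero p}} → x % p ≡ 0 → y % p ≡ 0 → w % p ≡ 0 → diag a b (c′ * p) d x y z w % p ≡ 0
diag-singular-divisible p a b c′ d x y z w x≡0 y≡0 w≡0 = n∣m⇒m%n≡0 _ p
  (∣m∣n⇒∣m+n (∣m∣n⇒∣m+n (∣m∣n⇒∣m+n (∣n⇒∣m*n a (∣n⇒∣m*n x (m%n≡0⇒n∣m x p x≡0))) (∣n⇒∣m*n b (∣n⇒∣m*n y (m%n≡0⇒n∣m y p y≡0))))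
      (∣m⇒∣m*n (z * z) (n∣m*n c′)))
      (∣n⇒∣m*n d (∣n⇒∣m*n w (m%n≡0⇒n∣m w p w≡0))))

diag-z-divisible : ∀ p a b c′ d x y z w .{{_ : NonZero p}} → z % p ≡ 0 → diag (a * p) (b * p) c′ (d * p) x y z w % p ≡ 0
diag-z-divisible p a b c′ d x y z w z≡0 = n∣m⇒m%n≡0 _ p
  (∣m∣n⇒∣m+n (∣m∣n⇒∣m+n (∣m∣n⇒∣m+n (∣m⇒∣m*n (x * x) (n∣m*n a)) (∣m⇒∣m*n (y * y) (n∣m*n b)))
      (∣n⇒∣m*n c′ (∣n⇒∣m*n z (m%n≡0⇒n∣m z p z≡0))))
      (∣m⇒∣m*n (w * w) (n∣m*n d)))

%-pow-reduce : ∀ p v A B .{{_ : NonZero p}} → (A % p ^ suc v) {{m^n≢0 p (suc v)}} ≡ (B % p ^ suc v) {{m^n≢0 p (suc v)}} → A % p ≡ B % p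
%-pow-reduce p v A B e = trans (sym (m∣n⇒o%n%m≡o%m p (p ^ suc v) A {{_}} {{m^n≢0 p (suc v)}} (m∣m*n (p ^ v))))
   (trans (cong (_% p) e) (m∣n⇒o%n%m≡o%m p (p ^ suc v) B {{_}} {{m^n≢0 p (suc v)}} (m∣m*n (p ^ v))))

diag-scale : ∀ a b c d x y z w p → diag a b c d (x * p) (y * p) (z * p) (w * p) ≡ diag a b c d x y z w * (p * p)
diag-scale = solve 9 (λ a b c d x y z w p →
  a :* ((x :* p) :* (x :* p)) :+ b :* ((y :* p) :* (y :* p)) :+ c :* ((z :* p) :* (z :* p)) :+ d :* ((w :* p) :* (w :* p))
  := (a :* (x :* x) :+ b :* (y :* y) :+ c :* (z :* z) :+ d :* (w :* w)) :* (p :* p)) refl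

diag-singular-expand : ∀ a b c′ d x y z w p →
  diag a b (c′ * p) d (x * p) (y * p) z (w * p) ≡ (c′ * (z * z)) * p + (a * (x * x) + b * (y * y) + d * (w * w)) * (p * p)
diag-singular-expand = solve 9 (λ a b c′ d x y z w p →
  a :* ((x :* p) :* (x :* p)) :+ b :* ((y :* p) :* (y :* p)) :+ (c′ :* p) :* (z :* z) :+ d :* ((w :* p) :* (w :* p))
  := (c′ :* (z :* z)) :* p :+ (a :* (x :* x) :+ b :* (y :* y) :+ d :* (w :* w)) :* (p :* p)) refl

^-suc-suc : ∀ p n → p ^ suc (suc n) ≡ p ^ n * (p * p)
^-suc-suc p n = trans (sym (*-assoc p p (p ^ n))) (*-comm (p * p) (p ^ n))

ind-%-zero-cases : ∀ (X : ℕ → ℕ) z p .{{_ : NonZero p}} → (z % p ≢ 0 → X z ≡ 0) → X z ≡ ind (z % p ≡ᵇ 0) * X z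
ind-%-zero-cases X z p h with z % p ≟ 0
... | yes e rewrite ind-≡ (z % p) 0 e = sym (+-identityʳ (X z))
... | no ne rewrite ind-≢ (z % p) 0 ne = h ne

-- A singular solution of F ≡ p² M has z ≡ 0 as c′ is a unit mod p, so it is p times a point
-- (x, y, z, w) with F (x, y, z, w) ≡ M (mod pⁿ); each such point mod pⁿ has p⁴ lifts mod pⁿ⁺¹.
singular-solutions-p² : ∀ p n M a b c′ d .{{_ : NonZero p}} →
  (∀ z → z % p ≢ 0 → (c′ * (z * z)) % p ≢ 0) →
  solutions^ p (suc (suc n)) (residue p (suc (suc n)) (p * p * M)) (singular p) (diag a b (c′ * p) d)
    ≡ p * (p * (p * (p * 1))) * solutions^ p n (residue p n M) always (diag a b (c′ * p) d)
singular-solutions-p² p n M a b c′ d c′-square-unit =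
  trans (singular-solutions p (suc n) r F)
  (trans (sumBelow-cong pⁿ⁺¹ λ x _ → sumBelow-cong pⁿ⁺¹ λ y _ →
     trans (sumBelow-cong pⁿ⁺² λ z _ → ind-%-zero-cases (λ z → sumBelow pⁿ⁺¹ λ w → X x y z w) z p
                    (λ z≢0 → sumBelow-zeros pⁿ⁺¹ _ λ w _ → X-off-multiples x y z w z≢0))
           (sumBelow-multiples p (suc n) (λ z → sumBelow pⁿ⁺¹ λ w → X x y z w)))
  (trans (Σ4-cong pⁿ⁺¹ λ x y z w _ _ _ _ → X-on-multiples x y z w)
  (trans (Σ4-periodic p (p ^ n) (λ x y z w → ind ((F x y z w % p ^ n) {{m^n≢0 p n}} ≡ᵇ residue p n M))
            (λ x y z w t s r q → cong (λ u → ind (u ≡ᵇ residue p n M)) (diag-%-translate a b (c′ * p) d (p ^ n) x y z w t s r q {{m^n≢0 p n}})))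
   (cong (p * (p * (p * (p * 1))) *_) (sym (solutions-always (p ^ n) (residue p n M) F {{m^n≢0 p n}}))))))
  where
  F = diag a b (c′ * p) d
  pⁿ⁺¹ = p ^ suc n
  pⁿ⁺² = p ^ suc (suc n)
  r = residue p (suc (suc n)) (p * p * M)
  X : Fun4
  X x y z w = ind ((F (x * p) (y * p) z (w * p) % pⁿ⁺²) {{m^n≢0 p (suc (suc n))}} ≡ᵇ r)
  instance
    _ : NonZero (p ^ n * (p * p))
    _ = m*n≢0 (p ^ n) (p * p) {{m^n≢0 p n}} {{m*n≢0 p p}}
    _ : NonZero (p * p)
    _ = m*n≢0 p p
  p²∣pⁿ⁺² : (p * p) ∣ pⁿ⁺²
  p²∣pⁿ⁺² = divides (p ^ n) (^-suc-suc p n)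
  -- c′ z² p ≡ F (p x, p y, z, p w) ≡ p² M ≡ 0 (mod p²), so p ∣ c′ z².
  X-off-multiples : ∀ x y z w → z % p ≢ 0 → X x y z w ≡ 0
  X-off-multiples x y z w z≢0 = ind-≢ _ _ λ e → c′-square-unit z z≢0 (*-cancelʳ-≡ _ 0 p (trans (m%n*o≡m*o%[n*o] (c′ * (z * z)) p p)
      (trans (sym ([m+kn]%n≡m%n ((c′ * (z * z)) * p) (a * (x * x) + b * (y * y) + d * (w * w)) (p * p)))
      (trans (cong (_% (p * p)) (sym (diag-singular-expand a b c′ d x y z w p)))
      (trans (sym (m∣n⇒o%n%m≡o%m (p * p) pⁿ⁺² (F (x * p) (y * p) z (w * p)) {{_}} {{m^n≢0 p (suc (suc n))}} p²∣pⁿ⁺²))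
      (trans (cong (_% (p * p)) e)
      (trans (m∣n⇒o%n%m≡o%m (p * p) pⁿ⁺² (p * p * M) {{_}} {{m^n≢0 p (suc (suc n))}} p²∣pⁿ⁺²)
             (trans (cong (_% (p * p)) (*-comm (p * p) M)) (m*n%n≡0 M (p * p))))))))))
  X-on-multiples : ∀ x y z w → X x y (z * p) w ≡ ind ((F x y z w % p ^ n) {{m^n≢0 p n}} ≡ᵇ residue p n M)
  X-on-multiples x y z w = trans (cong₂ (λ u v → ind (u ≡ᵇ v))
      (trans (cong (λ u → (u % pⁿ⁺²) {{m^n≢0 p (suc (suc n))}}) (diag-scale a b (c′ * p) d x y z w p))
             (%-congʳ {o = F x y z w * (p * p)} {{m^n≢0 p (suc (suc n))}} {{_}} (^-suc-suc p n)))
      (trans (cong (λ u → (u % pⁿ⁺²) {{m^n≢0 p (suc (suc n))}}) (*-comm (p * p) M))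
             (%-congʳ {o = M * (p * p)} {{m^n≢0 p (suc (suc n))}} {{_}} (^-suc-suc p n))))
    (ind-%-scale (p * p) (F x y z w) M (p ^ n) {{m*n≢0 p p}} {{m^n≢0 p n}} {{m*n≢0 (p ^ n) (p * p) {{m^n≢0 p n}} {{m*n≢0 p p}}}})

diag-singular-factor : ∀ a b c′ d x y z w p → diag a b (c′ * p) d (x * p) (y * p) z (w * p) ≡ diag (a * p) (b * p) c′ (d * p) x y z w * p
diag-singular-factor = solve 9 (λ a b c′ d x y z w p →
  a :* ((x :* p) :* (x :* p)) :+ b :* ((y :* p) :* (y :* p)) :+ (c′ :* p) :* (z :* z) :+ d :* ((w :* p) :* (w :* p))
  := ((a :* p) :* (x :* x) :+ (b :* p) :* (y :* y) :+ c′ :* (z :* z) :+ (d :* p) :* (w :* w)) :* p) refl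

diag-%-translate-z : ∀ a b c d S x y z w r .{{_ : NonZero S}} → diag a b c d x y (z + r * S) w % S ≡ diag a b c d x y z w % S
diag-%-translate-z a b c d S x y z w r = trans (cong (_% S) (sym (without-zero-shifts (+-identityʳ x) (+-identityʳ y) (+-identityʳ w))))
   (diag-%-translate a b c d S x y z w 0 0 r 0)
  where
  without-zero-shifts : x + 0 ≡ x → y + 0 ≡ y → w + 0 ≡ w → diag a b c d (x + 0) (y + 0) (z + r * S) (w + 0) ≡ diag a b c d x y (z + r * S) w
  without-zero-shifts e1 e2 e3 rewrite e1 | e2 | e3 = refl

-- At a singular point (p x, p y, z, p w) the form is p F′ (x, y, z, w), and F′ mod pⁿ⁺¹ does not
-- depend on z beyond its residue mod pⁿ⁺¹, whence the factor p from the range pⁿ⁺² of z.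
singular-solutions-p : ∀ p n u a b c′ d .{{_ : NonZero p}} →
  solutions^ p (suc (suc n)) (residue p (suc (suc n)) (p * u)) (singular p) (diag a b (c′ * p) d)
    ≡ p * solutions^ p (suc n) (residue p (suc n) u) always (diag (a * p) (b * p) c′ (d * p))
singular-solutions-p p n u a b c′ d {{p≢0}} =
  trans (singular-solutions p (suc n) r F)
  (trans (sumBelow-cong pⁿ⁺¹ λ x _ → sumBelow-cong pⁿ⁺¹ λ y _ →
     trans (sumBelow-cong pⁿ⁺² λ z _ → sumBelow-cong pⁿ⁺¹ λ w _ → reduce x y z w)
           (sumBelow-periodic p pⁿ⁺¹ (λ z → sumBelow pⁿ⁺¹ λ w → Y x y z w)
              (λ z t → sumBelow-cong pⁿ⁺¹ λ w _ → cong (λ v → ind (v ≡ᵇ residue p (suc n) u))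
                                                       (diag-%-translate-z (a * p) (b * p) c′ (d * p) pⁿ⁺¹ x y z w t {{m^n≢0 p (suc n)}}))))
  (trans (sumBelow-cong pⁿ⁺¹ λ x _ → sumBelow-* pⁿ⁺¹ p _)
  (trans (sumBelow-* pⁿ⁺¹ p _)
   (cong (p *_) (sym (solutions-always pⁿ⁺¹ (residue p (suc n) u) F′ {{m^n≢0 p (suc n)}}))))))
  where
  F = diag a b (c′ * p) d
  F′ = diag (a * p) (b * p) c′ (d * p)
  pⁿ⁺¹ = p ^ suc n
  pⁿ⁺² = p ^ suc (suc n)
  r = residue p (suc (suc n)) (p * u)
  Y : Fun4
  Y x y z w = ind ((F′ x y z w % pⁿ⁺¹) {{m^n≢0 p (suc n)}} ≡ᵇ residue p (suc n) u)
  reduce : ∀ x y z w → ind ((F (x * p) (y * p) z (w * p) % pⁿ⁺²) {{m^n≢0 p (suc (suc n))}} ≡ᵇ r) ≡ Y x y z w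
  reduce x y z w = trans (cong₂ (λ u v → ind (u ≡ᵇ v))
      (trans (cong (λ v → (v % pⁿ⁺²) {{m^n≢0 p (suc (suc n))}}) (diag-singular-factor a b c′ d x y z w p))
             (%-congʳ {o = F′ x y z w * p} {{m^n≢0 p (suc (suc n))}} {{m*n≢0 pⁿ⁺¹ p {{m^n≢0 p (suc n)}}}} (*-comm p pⁿ⁺¹)))
      (trans (cong (λ v → (v % pⁿ⁺²) {{m^n≢0 p (suc (suc n))}}) (*-comm p u))
             (%-congʳ {o = u * p} {{m^n≢0 p (suc (suc n))}} {{m*n≢0 pⁿ⁺¹ p {{m^n≢0 p (suc n)}}}} (*-comm p pⁿ⁺¹))))
    (ind-%-scale p (F′ x y z w) u pⁿ⁺¹ {{p≢0}} {{m^n≢0 p (suc n)}} {{m*n≢0 pⁿ⁺¹ p {{m^n≢0 p (suc n)}}}})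

ind-%-unit-mismatch : ∀ p v A u .{{_ : NonZero p}} → A % p ≡ 0 → u % p ≢ 0 →
  ind ((A % p ^ suc v) {{m^n≢0 p (suc v)}} ≡ᵇ residue p (suc v) u) ≡ 0
ind-%-unit-mismatch p v A u A≡0 u≢0 = ind-≢ _ _ λ e → u≢0 (trans (sym (%-pow-reduce p v A u e)) A≡0)

singular-solutions-unit : ∀ p v u a b c′ d .{{_ : NonZero p}} → u % p ≢ 0 →
  solutions^ p (suc v) (residue p (suc v) u) (singular p) (diag a b (c′ * p) d) ≡ 0
singular-solutions-unit p v u a b c′ d u≢0 = trans (Σ4-cong (p ^ suc v) λ x y z w _ _ _ _ → pointwise x y z w) (Σ4-zero (p ^ suc v))
  where
  pointwise : ∀ x y z w → ind (singular p x y z w) * ind ((diag a b (c′ * p) d x y z w % p ^ suc v) {{m^n≢0 p (suc v)}} ≡ᵇ residue p (suc v) u) ≡ 0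
  pointwise x y z w with x % p ≟ 0 | y % p ≟ 0 | w % p ≟ 0
  ... | no x≢0 | _ | _ rewrite ≡ᵇ-false (x % p) 0 x≢0 = refl
  ... | yes x≡0 | no y≢0 | _ rewrite ≡ᵇ-true (x % p) 0 x≡0 | ≡ᵇ-false (y % p) 0 y≢0 = refl
  ... | yes x≡0 | yes y≡0 | no w≢0
    rewrite ≡ᵇ-true (x % p) 0 x≡0 | ≡ᵇ-true (y % p) 0 y≡0 | ≡ᵇ-false (w % p) 0 w≢0 = refl
  ... | yes x≡0 | yes y≡0 | yes w≡0
    rewrite ≡ᵇ-true (x % p) 0 x≡0 | ≡ᵇ-true (y % p) 0 y≡0 | ≡ᵇ-true (w % p) 0 w≡0 =
    trans (+-identityʳ _) (ind-%-unit-mismatch p v _ u (diag-singular-divisible p a b c′ d x y z w x≡0 y≡0 w≡0) u≢0)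

solutions-z-regular : ∀ p n u a b c′ d .{{_ : NonZero p}} → u % p ≢ 0 →
  solutions^ p (suc n) (residue p (suc n) u) always (diag (a * p) (b * p) c′ (d * p))
    ≡ solutions^ p (suc n) (residue p (suc n) u) (z-regular p) (diag (a * p) (b * p) c′ (d * p))
solutions-z-regular p n u a b c′ d u≢0 = Σ4-cong (p ^ suc n) λ x y z w _ _ _ _ → pointwise x y z w
  where
  pointwise : ∀ x y z w → 1 * ind ((diag (a * p) (b * p) c′ (d * p) x y z w % p ^ suc n) {{m^n≢0 p (suc n)}} ≡ᵇ residue p (suc n) u)
     ≡ ind (z-regular p x y z w) * ind ((diag (a * p) (b * p) c′ (d * p) x y z w % p ^ suc n) {{m^n≢0 p (suc n)}} ≡ᵇ residue p (suc n) u)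
  pointwise x y z w with z % p ≟ 0
  ... | no z≢0 rewrite ≡ᵇ-false (z % p) 0 z≢0 = refl
  ... | yes z≡0 rewrite ≡ᵇ-true (z % p) 0 z≡0 = trans (+-identityʳ _) (ind-%-unit-mismatch p n _ u (diag-z-divisible p a b c′ d x y z w z≡0) u≢0)

geometric-iterate : ∀ (G : ℕ → ℕ) K → (∀ v → G (suc v) ≡ K * G v) → ∀ v → G v ≡ K ^ v * G 0
geometric-iterate G K h zero = sym (+-identityʳ (G 0))
geometric-iterate G K h (suc v) rewrite h v | geometric-iterate G K h v = sym (*-assoc K (K ^ v) (G 0))

allBelow : ℕ → (ℕ → Bool) → Bool
allBelow zero    f = true
allBelow (suc n) f = allBelow n f ∧ f n

allBelow-sound : ∀ n f → T (allBelow n f) → ∀ i → i < n → T (f i)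
allBelow-sound (suc n) f h i i<1+n with Equivalence.to T-∧ h | m≤n⇒m<n∨m≡n (≤-pred i<1+n)
... | h₁ , _  | inj₁ i<n  = allBelow-sound n f h₁ i i<n
... | _  , h₂ | inj₂ refl = h₂

T-∨-false : ∀ a b → T (a ∨ b) → a ≡ false → T b
T-∨-false false b h _ = h

T-not⇒≢true : ∀ b → T (not b) → b ≢ true
T-not⇒≢true false _ ()

%-line : ∀ p B c t .{{_ : NonZero p}} → (B + c * t) % p ≡ (B % p + (c % p) * t) % p
%-line p B c t = begin
  (B + c * t) % p                           ≡⟨ %-distribˡ-+ B (c * t) p ⟩
  (B % p + (c * t) % p) % p                 ≡⟨ cong (λ u → (B % p + u) % p) (%-distribˡ-* c t p) ⟩
  (B % p + ((c % p) * (t % p)) % p) % p     ≡⟨ cong (λ u → (B % p + (u * (t % p)) % p) % p) (sym (m%n%n≡m%n c p)) ⟩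
  (B % p + ((c % p % p) * (t % p)) % p) % p ≡⟨ cong (λ u → (B % p + u) % p) (sym (%-distribˡ-* (c % p) t p)) ⟩
  (B % p + (c % p) * t % p) % p             ≡⟨ cong (λ u → (u + (c % p) * t % p) % p) (sym (m%n%n≡m%n B p)) ⟩
  (B % p % p + (c % p) * t % p) % p         ≡⟨ sym (%-distribˡ-+ (B % p) ((c % p) * t) p) ⟩
  (B % p + (c % p) * t) % p                 ∎
  where open ≡-Reasoning

lineHitsᵇ : ∀ p K e .{{_ : NonZero p}} → Bool
lineHitsᵇ p K e = allBelow p λ b → allBelow p λ c → allBelow p λ γ →
  (c ≡ᵇ 0) ∨ (sumBelow K (λ t → ind ((b + c * t) % p ≡ᵇ γ)) ≡ᵇ e)

lineHitsᵇ-sound : ∀ p K e .{{_ : NonZero p}} → T (lineHitsᵇ p K e) →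
  ∀ c γ → c % p ≢ 0 → γ < p → LineHits p K e c γ
lineHitsᵇ-sound p K e h c γ c≢0 γ<p B =
  trans (sumBelow-cong K λ t _ → cong (λ u → ind (u ≡ᵇ γ)) (%-line p B c t))
        (≡ᵇ⇒≡ _ e (T-∨-false _ _ at-residues (≡ᵇ-false (c % p) 0 c≢0)))
  where
  at-residues = allBelow-sound p _ (allBelow-sound p _ (allBelow-sound p _ h (B % p) (m%n<n B p))
                                                        (c % p) (m%n<n c p)) γ γ<p

%-Compatible : ∀ p .{{_ : NonZero p}} → (ℕ → ℕ) → Set
%-Compatible p f = ∀ z → f z % p ≡ f (z % p) % p

nonVanishingᵇ : ∀ p .{{_ : NonZero p}} → (ℕ → ℕ) → Bool
nonVanishingᵇ p f = allBelow p λ r → (r ≡ᵇ 0) ∨ not (f r % p ≡ᵇ 0)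

nonVanishingᵇ-sound : ∀ p f .{{_ : NonZero p}} → %-Compatible p f → T (nonVanishingᵇ p f) →
  ∀ z → z % p ≢ 0 → f z % p ≢ 0
nonVanishingᵇ-sound p f compat h z z≢0 fz≡0 =
  T-not⇒≢true _ (T-∨-false _ _ (allBelow-sound p _ h (z % p) (m%n<n z p)) (≡ᵇ-false (z % p) 0 z≢0))
                (≡ᵇ-true _ 0 (trans (sym (compat z)) fz≡0))

*-%-compatible : ∀ p k .{{_ : NonZero p}} → %-Compatible p (k *_)
*-%-compatible p k z = begin
  (k * z) % p                   ≡⟨ %-distribˡ-* k z p ⟩
  ((k % p) * (z % p)) % p       ≡⟨ cong (λ u → ((k % p) * u) % p) (sym (m%n%n≡m%n z p)) ⟩
  ((k % p) * (z % p % p)) % p   ≡⟨ sym (%-distribˡ-* k (z % p) p) ⟩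
  (k * (z % p)) % p             ∎
  where open ≡-Reasoning

*-square-%-compatible : ∀ p k .{{_ : NonZero p}} → %-Compatible p (λ z → k * (z * z))
*-square-%-compatible p k z = begin
  (k * (z * z)) % p                     ≡⟨ *-%-compatible p k (z * z) ⟩
  (k * ((z * z) % p)) % p               ≡⟨ cong (λ u → (k * u) % p) (%-distribˡ-* z z p) ⟩
  (k * (((z % p) * (z % p)) % p)) % p   ≡⟨ sym (*-%-compatible p k ((z % p) * (z % p))) ⟩
  (k * ((z % p) * (z % p))) % p         ∎
  where open ≡-Reasoning

regular-witness : ∀ p x y z w .{{_ : NonZero p}} → T (regular p x y z w) → x % p ≢ 0 ⊎ y % p ≢ 0 ⊎ w % p ≢ 0
regular-witness p x y z w h with x % p ≟ 0 | y % p ≟ 0 | w % p ≟ 0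
... | no x≢0 | _       | _       = inj₁ x≢0
... | yes _  | no y≢0  | _       = inj₂ (inj₁ y≢0)
... | yes _  | yes _   | no w≢0  = inj₂ (inj₂ w≢0)
... | yes x≡0 | yes y≡0 | yes w≡0
  rewrite ≡ᵇ-true (x % p) 0 x≡0 | ≡ᵇ-true (y % p) 0 y≡0 | ≡ᵇ-true (w % p) 0 w≡0 = ⊥-elim h

z-regular-witness : ∀ p x y z w .{{_ : NonZero p}} → T (z-regular p x y z w) → z % p ≢ 0
z-regular-witness p x y z w h z≡0 rewrite ≡ᵇ-true (z % p) 0 z≡0 = h

-- The Boolean checks say that p ∤ 2abc′d; F′ is the form met after dividing the singular points by p.
module OddPrimeCounts (p a b c′ d : ℕ) .{{_ : NonZero p}}
  (lines-ok : T (lineHitsᵇ p p 1))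
  (a-unit : T (nonVanishingᵇ p (2 * a *_))) (b-unit : T (nonVanishingᵇ p (2 * b *_)))
  (c′-unit : T (nonVanishingᵇ p (2 * c′ *_))) (d-unit : T (nonVanishingᵇ p (2 * d *_)))
  (c′-square-unit : T (nonVanishingᵇ p (λ z → c′ * (z * z)))) where

  F : Fun4
  F = diag a b (c′ * p) d

  F′ : Fun4
  F′ = diag (a * p) (b * p) c′ (d * p)

  p∣p^suc : ∀ v → p ∣ p ^ suc v
  p∣p^suc v = m∣m*n (p ^ v)

  line : ∀ k → T (nonVanishingᵇ p (k *_)) → ∀ γ z → γ < p → z % p ≢ 0 → LineHits p p 1 (k * z) γ
  line k k-unit γ z γ<p z≢0 =
    lineHitsᵇ-sound p p 1 lines-ok (k * z) γ (nonVanishingᵇ-sound p (k *_) (*-%-compatible p k) k-unit z z≢0) γ<p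

  regular-step : ∀ v m →
    solutions^ p (suc (suc v)) (residue p (suc (suc v)) m) (regular p) F
      ≡ p * (p * (p * 1)) * solutions^ p (suc v) (residue p (suc v) m) (regular p) F
  regular-step v m = hensel-step-odd p v a b (c′ * p) d m (regular p) (regular-translate p (p ^ suc v) (p∣p^suc v)) hits
    where
    γ = digit p (suc v) m
    hits : ∀ x y z w → T (regular p x y z w) →
      LineHits p p 1 (2 * a * x) γ ⊎ LineHits p p 1 (2 * b * y) γ ⊎ LineHits p p 1 (2 * (c′ * p) * z) γ ⊎ LineHits p p 1 (2 * d * w) γ
    hits x y z w h with regular-witness p x y z w h
    ... | inj₁ x≢0        = inj₁ (line (2 * a) a-unit γ x (digit<p p (suc v) m) x≢0)
    ... | inj₂ (inj₁ y≢0) = inj₂ (inj₁ (line (2 * b) b-unit γ y (digit<p p (suc v) m) y≢0))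
    ... | inj₂ (inj₂ w≢0) = inj₂ (inj₂ (inj₂ (line (2 * d) d-unit γ w (digit<p p (suc v) m) w≢0)))

  z-regular-step : ∀ v m →
    solutions^ p (suc (suc v)) (residue p (suc (suc v)) m) (z-regular p) F′
      ≡ p * (p * (p * 1)) * solutions^ p (suc v) (residue p (suc v) m) (z-regular p) F′
  z-regular-step v m =
    hensel-step-odd p v (a * p) (b * p) c′ (d * p) m (z-regular p) (z-regular-translate p (p ^ suc v) (p∣p^suc v))
      λ x y z w h → inj₂ (inj₂ (inj₁ (line (2 * c′) c′-unit (digit p (suc v) m) z (digit<p p (suc v) m) (z-regular-witness p x y z w h))))

  regular-iterate : ∀ v m →
    solutions^ p (suc v) (residue p (suc v) m) (regular p) F
      ≡ (p * (p * (p * 1))) ^ v * solutions^ p 1 (residue p 1 m) (regular p) F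
  regular-iterate v m = geometric-iterate (λ n → solutions^ p (suc n) (residue p (suc n) m) (regular p) F) _ (λ n → regular-step n m) v

  z-regular-iterate : ∀ v m →
    solutions^ p (suc v) (residue p (suc v) m) (z-regular p) F′
      ≡ (p * (p * (p * 1))) ^ v * solutions^ p 1 (residue p 1 m) (z-regular p) F′
  z-regular-iterate v m = geometric-iterate (λ n → solutions^ p (suc n) (residue p (suc n) m) (z-regular p) F′) _ (λ n → z-regular-step n m) v

  solutions-unit : ∀ v u → u % p ≢ 0 →
    solutions^ p (suc v) (residue p (suc v) u) always F ≡ (p * (p * (p * 1))) ^ v * solutions^ p 1 (residue p 1 u) (regular p) F
  solutions-unit v u u≢0 =
    trans (solutions-split p (suc v) _ F)
          (trans (cong₂ _+_ (regular-iterate v u) (singular-solutions-unit p v u a b c′ d u≢0)) (+-identityʳ _))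

  solutions-p-unit : ∀ n u → u % p ≢ 0 →
    solutions^ p (suc (suc n)) (residue p (suc (suc n)) (p * u)) always F
      ≡ (p * (p * (p * 1))) ^ suc n * solutions^ p 1 (residue p 1 (p * u)) (regular p) F
        + p * ((p * (p * (p * 1))) ^ n * solutions^ p 1 (residue p 1 u) (z-regular p) F′)
  solutions-p-unit n u u≢0 =
    trans (solutions-split p (suc (suc n)) _ F)
          (cong₂ _+_ (regular-iterate (suc n) (p * u))
                     (trans (singular-solutions-p p n u a b c′ d)
                            (cong (p *_) (trans (solutions-z-regular p n u a b c′ d u≢0) (z-regular-iterate n u)))))

  solutions-p² : ∀ n M →
    solutions^ p (suc (suc n)) (residue p (suc (suc n)) (p * p * M)) always F
      ≡ (p * (p * (p * 1))) ^ suc n * solutions^ p 1 (residue p 1 (p * p * M)) (regular p) F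
        + p * (p * (p * (p * 1))) * solutions^ p n (residue p n M) always F
  solutions-p² n M =
    trans (solutions-split p (suc (suc n)) _ F)
          (cong₂ _+_ (regular-iterate (suc n) (p * p * M))
                     (singular-solutions-p² p n M a b c′ d
                        (nonVanishingᵇ-sound p (λ z → c′ * (z * z)) (*-square-%-compatible p c′) c′-square-unit)))

module TwoAdicCounts where

  F : Fun4
  F = diag 1 7 (1 * 2) 13

  F′ : Fun4
  F′ = diag (1 * 2) (7 * 2) 1 (13 * 2)

  line : ∀ k → T (nonVanishingᵇ 2 (k *_)) → ∀ γ z → γ < 2 → z % 2 ≢ 0 → LineHits 2 4 2 (k * z) γ
  line k k-odd γ z γ<2 z≢0 =
    lineHitsᵇ-sound 2 4 2 tt (k * z) γ (nonVanishingᵇ-sound 2 (k *_) (*-%-compatible 2 k) k-odd z z≢0) γ<2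

  regular-step : ∀ j m →
    solutions^ 2 (4 + j) (residue 2 (4 + j) m) (regular 2) F ≡ 8 * solutions^ 2 (3 + j) (residue 2 (3 + j) m) (regular 2) F
  regular-step j m = hensel-step-2 j 1 7 2 13 m (regular 2) (regular-translate 2 (2 ^ (2 + j)) (m∣m*n (2 ^ (1 + j)))) hits
    where
    γ = digit 2 (3 + j) m
    hits : ∀ x y z w → T (regular 2 x y z w) →
      LineHits 2 4 2 (1 * x) γ ⊎ LineHits 2 4 2 (7 * y) γ ⊎ LineHits 2 4 2 (2 * z) γ ⊎ LineHits 2 4 2 (13 * w) γ
    hits x y z w h with regular-witness 2 x y z w h
    ... | inj₁ x≢0        = inj₁ (line 1 tt γ x (digit<p 2 (3 + j) m) x≢0)
    ... | inj₂ (inj₁ y≢0) = inj₂ (inj₁ (line 7 tt γ y (digit<p 2 (3 + j) m) y≢0))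
    ... | inj₂ (inj₂ w≢0) = inj₂ (inj₂ (inj₂ (line 13 tt γ w (digit<p 2 (3 + j) m) w≢0)))

  z-regular-step : ∀ j m →
    solutions^ 2 (4 + j) (residue 2 (4 + j) m) (z-regular 2) F′ ≡ 8 * solutions^ 2 (3 + j) (residue 2 (3 + j) m) (z-regular 2) F′
  z-regular-step j m =
    hensel-step-2 j 2 14 1 26 m (z-regular 2) (z-regular-translate 2 (2 ^ (2 + j)) (m∣m*n (2 ^ (1 + j))))
      λ x y z w h → inj₂ (inj₂ (inj₁ (line 1 tt (digit 2 (3 + j) m) z (digit<p 2 (3 + j) m) (z-regular-witness 2 x y z w h))))

  regular-iterate : ∀ n m →
    solutions^ 2 (3 + n) (residue 2 (3 + n) m) (regular 2) F ≡ 8 ^ n * solutions^ 2 3 (residue 2 3 m) (regular 2) F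
  regular-iterate n m = geometric-iterate (λ k → solutions^ 2 (3 + k) (residue 2 (3 + k) m) (regular 2) F) 8 (λ k → regular-step k m) n

  z-regular-iterate : ∀ n m →
    solutions^ 2 (3 + n) (residue 2 (3 + n) m) (z-regular 2) F′ ≡ 8 ^ n * solutions^ 2 3 (residue 2 3 m) (z-regular 2) F′
  z-regular-iterate n m = geometric-iterate (λ k → solutions^ 2 (3 + k) (residue 2 (3 + k) m) (z-regular 2) F′) 8 (λ k → z-regular-step k m) n

  solutions-unit : ∀ n u → u % 2 ≢ 0 →
    solutions^ 2 (3 + n) (residue 2 (3 + n) u) always F ≡ 8 ^ n * solutions^ 2 3 (residue 2 3 u) (regular 2) F
  solutions-unit n u u≢0 =
    trans (solutions-split 2 (3 + n) _ F)
          (trans (cong₂ _+_ (regular-iterate n u) (singular-solutions-unit 2 (2 + n) u 1 7 1 13 u≢0)) (+-identityʳ _))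

  solutions-2-unit : ∀ n u → u % 2 ≢ 0 →
    solutions^ 2 (4 + n) (residue 2 (4 + n) (2 * u)) always F
      ≡ 8 ^ suc n * solutions^ 2 3 (residue 2 3 (2 * u)) (regular 2) F + 2 * (8 ^ n * solutions^ 2 3 (residue 2 3 u) (z-regular 2) F′)
  solutions-2-unit n u u≢0 =
    trans (solutions-split 2 (4 + n) _ F)
          (cong₂ _+_ (regular-iterate (suc n) (2 * u))
                     (trans (singular-solutions-p 2 (2 + n) u 1 7 1 13)
                            (cong (2 *_) (trans (solutions-z-regular 2 (2 + n) u 1 7 1 13 u≢0) (z-regular-iterate n u)))))

  solutions-4 : ∀ n M →
    solutions^ 2 (3 + n) (residue 2 (3 + n) (2 * 2 * M)) always F
      ≡ 8 ^ n * solutions^ 2 3 (residue 2 3 (2 * 2 * M)) (regular 2) F + 16 * solutions^ 2 (1 + n) (residue 2 (1 + n) M) always F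
  solutions-4 n M =
    trans (solutions-split 2 (3 + n) _ F)
          (cong₂ _+_ (regular-iterate n (2 * 2 * M))
                     (singular-solutions-p² 2 (1 + n) M 1 7 1 13 (nonVanishingᵇ-sound 2 (λ z → 1 * (z * z)) (*-square-%-compatible 2 1) tt)))

/-≡-suc : ∀ a b′ c d′ → a * suc d′ ≡ c * suc b′ → + a / suc b′ ≡ + c / suc d′
/-≡-suc a b′ c d′ h =
  ℚP.fromℚᵘ-cong {mkℚᵘ (+ a) b′} {mkℚᵘ (+ c) d′}
    (*≡* (trans (sym (ℤP.pos-* a (suc d′))) (trans (cong +_ h) (ℤP.pos-* c (suc b′)))))

/-*-suc : ∀ a b′ c d′ → (+ a / suc b′) ℚ.* (+ c / suc d′) ≡ + (a * c) / (suc b′ * suc d′)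
/-*-suc a b′ c d′ = ℚP.toℚᵘ-injective
  (ℚᵘP.≃-trans (ℚP.toℚᵘ-homo-* (+ a / suc b′) (+ c / suc d′))
  (ℚᵘP.≃-trans (ℚᵘP.*-cong (ℚP.toℚᵘ-fromℚᵘ (mkℚᵘ (+ a) b′)) (ℚP.toℚᵘ-fromℚᵘ (mkℚᵘ (+ c) d′)))
  (ℚᵘP.≃-trans (ℚᵘP.≃-reflexive (cong (λ n → mkℚᵘ n (pred (suc b′ * suc d′))) (sym (ℤP.pos-* a c))))
               (ℚᵘP.≃-sym (ℚP.toℚᵘ-fromℚᵘ (mkℚᵘ (+ (a * c)) (pred (suc b′ * suc d′))))))))

/-+-suc : ∀ a b′ c d′ → (+ a / suc b′) ℚ.+ (+ c / suc d′) ≡ + (a * suc d′ + c * suc b′) / (suc b′ * suc d′)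
/-+-suc a b′ c d′ = ℚP.toℚᵘ-injective
  (ℚᵘP.≃-trans (ℚP.toℚᵘ-homo-+ (+ a / suc b′) (+ c / suc d′))
  (ℚᵘP.≃-trans (ℚᵘP.+-cong (ℚP.toℚᵘ-fromℚᵘ (mkℚᵘ (+ a) b′)) (ℚP.toℚᵘ-fromℚᵘ (mkℚᵘ (+ c) d′)))
  (ℚᵘP.≃-trans (ℚᵘP.≃-reflexive (cong (λ n → mkℚᵘ n (pred (suc b′ * suc d′))) numerator))
               (ℚᵘP.≃-sym (ℚP.toℚᵘ-fromℚᵘ (mkℚᵘ (+ (a * suc d′ + c * suc b′)) (pred (suc b′ * suc d′))))))))
  where
  numerator : + a ℤ.* + suc d′ ℤ.+ + c ℤ.* + suc b′ ≡ + (a * suc d′ + c * suc b′)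
  numerator = trans (cong₂ ℤ._+_ (sym (ℤP.pos-* a (suc d′))) (sym (ℤP.pos-* c (suc b′))))
                    (sym (ℤP.pos-+ (a * suc d′) (c * suc b′)))

/-suc-pred : ∀ a b .{{_ : NonZero b}} → + a / b ≡ + a / suc (pred b)
/-suc-pred a b = ℚP./-cong {+ a} {b} {+ a} {suc (pred b)} refl (sym (suc-pred b))

/-≡ : ∀ a b c d .{{_ : NonZero b}} .{{_ : NonZero d}} → a * d ≡ c * b → + a / b ≡ + c / d
/-≡ a b c d h =
  trans (/-suc-pred a b)
  (trans (/-≡-suc a (pred b) c (pred d) (trans (cong (a *_) (suc-pred d)) (trans h (cong (c *_) (sym (suc-pred b))))))
         (sym (/-suc-pred c d)))

/-* : ∀ a b c d .{{_ : NonZero b}} .{{_ : NonZero d}} {{_ : NonZero (b * d)}} →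
  (+ a / b) ℚ.* (+ c / d) ≡ + (a * c) / (b * d)
/-* a b c d =
  trans (cong₂ ℚ._*_ (/-suc-pred a b) (/-suc-pred c d))
  (trans (/-*-suc a (pred b) c (pred d))
         (ℚP./-cong {+ (a * c)} {suc (pred b) * suc (pred d)} {+ (a * c)} {b * d} refl
                    (cong₂ _*_ (suc-pred b) (suc-pred d))))

/-+ : ∀ a b c d .{{_ : NonZero b}} .{{_ : NonZero d}} {{_ : NonZero (b * d)}} →
  (+ a / b) ℚ.+ (+ c / d) ≡ + (a * d + c * b) / (b * d)
/-+ a b c d =
  trans (cong₂ ℚ._+_ (/-suc-pred a b) (/-suc-pred c d))
  (trans (/-+-suc a (pred b) c (pred d))
         (ℚP./-cong {+ (a * suc (pred d) + c * suc (pred b))} {suc (pred b) * suc (pred d)}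
                    {+ (a * d + c * b)} {b * d}
                    (cong +_ (cong₂ _+_ (cong (a *_) (suc-pred d)) (cong (c *_) (suc-pred b))))
                    (cong₂ _*_ (suc-pred b) (suc-pred d))))

fromℕ : ℕ → ℚ
fromℕ A = + A / 1

fracPow : ∀ p → .{{NonZero p}} → ℕ → ℕ → ℚ
fracPow p A e = fromℕ A ℚ.* inv p e

inv-+ : ∀ p a b .{{_ : NonZero p}} → inv p (a + b) ≡ inv p a ℚ.* inv p b
inv-+ p a b = sym (trans (/-* 1 (p ^ a) 1 (p ^ b) {{m^n≢0 p a}} {{m^n≢0 p b}} {{pᵃpᵇ≢0}})
                         (ℚP./-cong {+ 1} {p ^ a * p ^ b} {+ 1} {p ^ (a + b)} {{pᵃpᵇ≢0}} {{m^n≢0 p (a + b)}}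
                                    refl (sym (^-distribˡ-+-* p a b))))
  where pᵃpᵇ≢0 = m*n≢0 (p ^ a) (p ^ b) {{m^n≢0 p a}} {{m^n≢0 p b}}

fracPow-+ : ∀ p A B e .{{_ : NonZero p}} → fracPow p (A + B) e ≡ fracPow p A e ℚ.+ fracPow p B e
fracPow-+ p A B e = trans (cong (ℚ._* inv p e) fromℕ-+) (ℚP.*-distribʳ-+ (inv p e) (fromℕ A) (fromℕ B))
  where
  fromℕ-+ : fromℕ (A + B) ≡ fromℕ A ℚ.+ fromℕ B
  fromℕ-+ = sym (trans (/-+ A 1 B 1) (cong (λ n → + n / 1) (cong₂ _+_ (*-identityʳ A) (*-identityʳ B))))

fracPow-cancel : ∀ p j A e .{{_ : NonZero p}} → fracPow p (p ^ j * A) (j + e) ≡ fracPow p A e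
fracPow-cancel p j A e =
  trans (/-* (p ^ j * A) 1 1 (p ^ (j + e)) {{_}} {{m^n≢0 p (j + e)}} {{m*n≢0 1 _ {{_}} {{m^n≢0 p (j + e)}}}})
  (trans (/-≡ (p ^ j * A * 1) (1 * p ^ (j + e)) (A * 1) (1 * p ^ e)
              {{m*n≢0 1 _ {{_}} {{m^n≢0 p (j + e)}}}} {{m*n≢0 1 _ {{_}} {{m^n≢0 p e}}}} cross)
         (sym (/-* A 1 1 (p ^ e) {{_}} {{m^n≢0 p e}} {{m*n≢0 1 _ {{_}} {{m^n≢0 p e}}}})))
  where
  cross : p ^ j * A * 1 * (1 * p ^ e) ≡ A * 1 * (1 * p ^ (j + e))
  cross rewrite ^-distribˡ-+-* p j e =
    solve 3 (λ P A E → P :* A :* con 1 :* (con 1 :* E) := A :* con 1 :* (con 1 :* (P :* E))) refl (p ^ j) A (p ^ e)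

eventually-constant⇒density : ∀ p m L N .{{_ : NonZero p}} → (∀ n → ratio p m (n + N) ≡ L) → IsLocalDensity p m L
eventually-constant⇒density p m L N h ε ε>0 = N , λ v N≤v →
  subst (λ x → ℚ.∣ x ℚ.- L ∣ ℚ.< ε) (sym (trans (cong (λ n → ratio p m n) (sym (m∸n+n≡m N≤v))) (h (v ∸ N))))
        (subst (λ x → ℚ.∣ x ∣ ℚ.< ε) (sym (ℚP.+-inverseʳ L)) ε>0)

inv-2*suc : ∀ p k .{{_ : NonZero p}} → inv p (2 * suc k) ≡ inv p 2 ℚ.* inv p (2 * k)
inv-2*suc p k = trans (cong (λ x → inv p x) (*-suc 2 k)) (inv-+ p 2 (2 * k))

inv-2*suc+1 : ∀ p k .{{_ : NonZero p}} → inv p (2 * suc k + 1) ≡ inv p 2 ℚ.* inv p (2 * k + 1)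
inv-2*suc+1 p k = trans (cong (λ x → inv p (x + 1)) (*-suc 2 k)) (inv-+ p 2 (2 * k + 1))

*-affine : ∀ γ a g → γ ℚ.* (ℚ.1ℚ ℚ.+ a ℚ.* g) ≡ γ ℚ.+ a ℚ.* (γ ℚ.* g)
*-affine γ a g = begin
  γ ℚ.* (ℚ.1ℚ ℚ.+ a ℚ.* g)          ≡⟨ ℚP.*-distribˡ-+ γ ℚ.1ℚ (a ℚ.* g) ⟩
  γ ℚ.* ℚ.1ℚ ℚ.+ γ ℚ.* (a ℚ.* g)    ≡⟨ cong₂ ℚ._+_ (ℚP.*-identityʳ γ) (sym (ℚP.*-assoc γ a g)) ⟩
  γ ℚ.+ (γ ℚ.* a) ℚ.* g             ≡⟨ cong (λ x → γ ℚ.+ x ℚ.* g) (ℚP.*-comm γ a) ⟩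
  γ ℚ.+ (a ℚ.* γ) ℚ.* g             ≡⟨ cong (γ ℚ.+_) (ℚP.*-assoc a γ g) ⟩
  γ ℚ.+ a ℚ.* (γ ℚ.* g)             ∎
  where open ≡-Reasoning

affine-step : ∀ γ a g i c → γ ℚ.* (ℚ.1ℚ ℚ.+ a ℚ.* g) ℚ.+ (a ℚ.* i) ℚ.* c ≡ γ ℚ.+ a ℚ.* (γ ℚ.* g ℚ.+ i ℚ.* c)
affine-step γ a g i c = begin
  γ ℚ.* (ℚ.1ℚ ℚ.+ a ℚ.* g) ℚ.+ (a ℚ.* i) ℚ.* c      ≡⟨ cong₂ ℚ._+_ (*-affine γ a g) (ℚP.*-assoc a i c) ⟩
  (γ ℚ.+ a ℚ.* (γ ℚ.* g)) ℚ.+ a ℚ.* (i ℚ.* c)       ≡⟨ ℚP.+-assoc γ (a ℚ.* (γ ℚ.* g)) (a ℚ.* (i ℚ.* c)) ⟩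
  γ ℚ.+ (a ℚ.* (γ ℚ.* g) ℚ.+ a ℚ.* (i ℚ.* c))       ≡⟨ cong (γ ℚ.+_) (sym (ℚP.*-distribˡ-+ a (γ ℚ.* g) (i ℚ.* c))) ⟩
  γ ℚ.+ a ℚ.* (γ ℚ.* g ℚ.+ i ℚ.* c)                 ∎
  where open ≡-Reasoning

geom-suc : ∀ p k .{{_ : NonZero p}} → geom p (suc k) ≡ ℚ.1ℚ ℚ.+ inv p 2 ℚ.* geom p k
geom-suc p zero    = sym (trans (cong (ℚ.1ℚ ℚ.+_) (ℚP.*-zeroʳ (inv p 2))) (ℚP.+-identityʳ ℚ.1ℚ))
geom-suc p (suc k) = begin
  geom p (suc k) ℚ.+ inv p (2 * suc k)
    ≡⟨ cong₂ ℚ._+_ (geom-suc p k) (inv-2*suc p k) ⟩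
  (ℚ.1ℚ ℚ.+ inv p 2 ℚ.* geom p k) ℚ.+ inv p 2 ℚ.* inv p (2 * k)
    ≡⟨ ℚP.+-assoc ℚ.1ℚ (inv p 2 ℚ.* geom p k) (inv p 2 ℚ.* inv p (2 * k)) ⟩
  ℚ.1ℚ ℚ.+ (inv p 2 ℚ.* geom p k ℚ.+ inv p 2 ℚ.* inv p (2 * k))
    ≡⟨ cong (ℚ.1ℚ ℚ.+_) (sym (ℚP.*-distribˡ-+ (inv p 2) (geom p k) (inv p (2 * k)))) ⟩
  ℚ.1ℚ ℚ.+ inv p 2 ℚ.* (geom p k ℚ.+ inv p (2 * k)) ∎
  where open ≡-Reasoning

-- The three shapes of β_p(m) in the theorem, as functions of k = ⌊ord_p(m)/2⌋; γ is the density of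
-- the regular solutions and c the contribution of the last level.
evenOrderDensity : ∀ p → .{{NonZero p}} → ℚ → ℚ → ℕ → ℚ
evenOrderDensity p γ c k = γ ℚ.* geom p k ℚ.+ inv p (2 * k) ℚ.* c

oddOrderDensity : ∀ p → .{{NonZero p}} → ℚ → ℚ → ℕ → ℚ
oddOrderDensity p γ c k = γ ℚ.* geom p (suc k) ℚ.+ inv p (2 * k + 1) ℚ.* c

oddOrderDensity₀ : ∀ p → .{{NonZero p}} → ℚ → ℕ → ℚ
oddOrderDensity₀ p γ k = γ ℚ.* geom p (suc k)

evenOrderDensity-suc : ∀ p γ c k .{{_ : NonZero p}} →
  evenOrderDensity p γ c (suc k) ≡ γ ℚ.+ inv p 2 ℚ.* evenOrderDensity p γ c k
evenOrderDensity-suc p γ c k =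
  trans (cong₂ (λ g i → γ ℚ.* g ℚ.+ i ℚ.* c) (geom-suc p k) (inv-2*suc p k))
        (affine-step γ (inv p 2) (geom p k) (inv p (2 * k)) c)

oddOrderDensity-suc : ∀ p γ c k .{{_ : NonZero p}} →
  oddOrderDensity p γ c (suc k) ≡ γ ℚ.+ inv p 2 ℚ.* oddOrderDensity p γ c k
oddOrderDensity-suc p γ c k =
  trans (cong₂ (λ g i → γ ℚ.* g ℚ.+ i ℚ.* c) (geom-suc p (suc k)) (inv-2*suc+1 p k))
        (affine-step γ (inv p 2) (geom p (suc k)) (inv p (2 * k + 1)) c)

oddOrderDensity₀-suc : ∀ p γ k .{{_ : NonZero p}} →
  oddOrderDensity₀ p γ (suc k) ≡ γ ℚ.+ inv p 2 ℚ.* oddOrderDensity₀ p γ k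
oddOrderDensity₀-suc p γ k = trans (cong (γ ℚ.*_) (geom-suc p (suc k))) (*-affine γ (inv p 2) (geom p (suc k)))

ratio-p^2k : ∀ p γ (L : ℕ → ℚ) b₀ B u .{{_ : NonZero p}} → b₀ ≤ B →
  (∀ k → L (suc k) ≡ γ ℚ.+ inv p 2 ℚ.* L k) →
  (∀ v M → b₀ ≤ v → ratio p (p * p * M) (suc (suc v)) ≡ γ ℚ.+ inv p 2 ℚ.* ratio p M v) →
  (∀ n → ratio p u (n + B) ≡ L 0) →
  ∀ k n → ratio p (p ^ (2 * k) * u) (n + (B + 2 * k)) ≡ L k
ratio-p^2k p γ L b₀ B u b₀≤B L-suc step base zero n =
  trans (cong₂ (λ a b → ratio p a b) (+-identityʳ u) (cong (_+_ n) (+-identityʳ B))) (base n)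
ratio-p^2k p γ L b₀ B u b₀≤B L-suc step base (suc k) n = begin
  ratio p (p ^ (2 * suc k) * u) (n + (B + 2 * suc k))
    ≡⟨ cong₂ (λ a b → ratio p a b) argument level ⟩
  ratio p (p * p * (p ^ (2 * k) * u)) (suc (suc (n + (B + 2 * k))))
    ≡⟨ step _ _ (≤-trans b₀≤B (≤-trans (m≤m+n B (2 * k)) (m≤n+m (B + 2 * k) n))) ⟩
  γ ℚ.+ inv p 2 ℚ.* ratio p (p ^ (2 * k) * u) (n + (B + 2 * k))
    ≡⟨ cong (λ x → γ ℚ.+ inv p 2 ℚ.* x) (ratio-p^2k p γ L b₀ B u b₀≤B L-suc step base k n) ⟩
  γ ℚ.+ inv p 2 ℚ.* L k
    ≡⟨ sym (L-suc k) ⟩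
  L (suc k) ∎
  where
  open ≡-Reasoning
  argument : p ^ (2 * suc k) * u ≡ p * p * (p ^ (2 * k) * u)
  argument = trans (cong (λ e → p ^ e * u) (*-suc 2 k))
                   (solve 3 (λ p P u → p :* (p :* P) :* u := p :* p :* (P :* u)) refl p (p ^ (2 * k)) u)
  level : n + (B + 2 * suc k) ≡ 2 + (n + (B + 2 * k))
  level = solve 3 (λ n B k → n :+ (B :+ con 2 :* (con 1 :+ k)) := con 2 :+ (n :+ (B :+ con 2 :* k))) refl n B k

fracPow-p³ⁿ : ∀ p n A e .{{_ : NonZero p}} → fracPow p ((p * (p * (p * 1))) ^ n * A) (3 * n + e) ≡ fracPow p A e
fracPow-p³ⁿ p n A e = trans (cong (λ x → fracPow p (x * A) (3 * n + e)) (^-*-assoc p 3 n)) (fracPow-cancel p (3 * n) A e)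

fracPow-p⁴ : ∀ p C v .{{_ : NonZero p}} → fracPow p (p ^ 4 * C) (3 * suc (suc v)) ≡ inv p 2 ℚ.* fracPow p C (3 * v)
fracPow-p⁴ p C v = begin
  fracPow p (p ^ 4 * C) (3 * suc (suc v))
    ≡⟨ cong (fracPow p (p ^ 4 * C)) (solve 1 (λ v → con 3 :* (con 2 :+ v) := con 4 :+ (con 3 :* v :+ con 2)) refl v) ⟩
  fracPow p (p ^ 4 * C) (4 + (3 * v + 2))
    ≡⟨ fracPow-cancel p 4 C (3 * v + 2) ⟩
  fromℕ C ℚ.* inv p (3 * v + 2)
    ≡⟨ cong (fromℕ C ℚ.*_) (inv-+ p (3 * v) 2) ⟩
  fromℕ C ℚ.* (inv p (3 * v) ℚ.* inv p 2)
    ≡⟨ sym (ℚP.*-assoc (fromℕ C) (inv p (3 * v)) (inv p 2)) ⟩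
  fracPow p C (3 * v) ℚ.* inv p 2
    ≡⟨ ℚP.*-comm (fracPow p C (3 * v)) (inv p 2) ⟩
  inv p 2 ℚ.* fracPow p C (3 * v) ∎
  where open ≡-Reasoning

p∣⇒%≡0 : ∀ p x .{{_ : NonZero p}} → p ∣ x → x % p ≡ 0
p∣⇒%≡0 p x p∣x = n∣m⇒m%n≡0 x p p∣x

density-p^2k : ∀ p γ (L : ℕ → ℚ) b₀ B u .{{_ : NonZero p}} → b₀ ≤ B →
  (∀ k → L (suc k) ≡ γ ℚ.+ inv p 2 ℚ.* L k) →
  (∀ v M → b₀ ≤ v → ratio p (p * p * M) (suc (suc v)) ≡ γ ℚ.+ inv p 2 ℚ.* ratio p M v) →
  (∀ n → ratio p u (n + B) ≡ L 0) →
  ∀ k → IsLocalDensity p (p ^ (2 * k) * u) (L k)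
density-p^2k p γ L b₀ B u b₀≤B L-suc step base k =
  eventually-constant⇒density p _ (L k) (B + 2 * k) (ratio-p^2k p γ L b₀ B u b₀≤B L-suc step base k)

^-2k+1 : ∀ p k u → p ^ (2 * k + 1) * u ≡ p ^ (2 * k) * (p * u)
^-2k+1 p k u =
  trans (cong (_* u) (trans (^-distribˡ-+-* p (2 * k) 1) (cong (p ^ (2 * k) *_) (*-identityʳ p))))
        (*-assoc (p ^ (2 * k)) p u)

∤⇒%≢0 : ∀ p u .{{_ : NonZero p}} → ¬ (p ∣ u) → u % p ≢ 0
∤⇒%≢0 p u p∤u u%p≡0 = p∤u (m%n≡0⇒n∣m u p u%p≡0)

residue-1 : ∀ p u .{{_ : NonZero p}} → residue p 1 u ≡ u % p
residue-1 p u = %-congʳ {o = u} {{m^n≢0 p 1}} {{_}} (*-identityʳ p)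

module OddPrimeDensity (p a b c′ d : ℕ) .{{_ : NonZero p}}
  (lines-ok : T (lineHitsᵇ p p 1))
  (a-unit : T (nonVanishingᵇ p (2 * a *_))) (b-unit : T (nonVanishingᵇ p (2 * b *_)))
  (c′-unit : T (nonVanishingᵇ p (2 * c′ *_))) (d-unit : T (nonVanishingᵇ p (2 * d *_)))
  (c′-square-unit : T (nonVanishingᵇ p (λ z → c′ * (z * z))))
  (count≡ : ∀ v m → count (p ^ v) m {{m^n≢0 p v}} ≡ solutions^ p v (residue p v m) always (diag a b (c′ * p) d))
  (γ : ℚ) (γ≡ : fracPow p (solutions^ p 1 0 (regular p) (diag a b (c′ * p) d)) 3 ≡ γ) where

  open OddPrimeCounts p a b c′ d lines-ok a-unit b-unit c′-unit d-unit c′-square-unit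

  G : ℕ → ℕ
  G r = solutions^ p 1 r (regular p) F

  G′ : ℕ → ℕ
  G′ r = solutions^ p 1 r (z-regular p) F′

  ratio≡ : ∀ v m → ratio p m v ≡ fracPow p (solutions^ p v (residue p v m) always F) (3 * v)
  ratio≡ v m = cong (λ A → fracPow p A (3 * v)) (count≡ v m)

  fracPow-lift : ∀ n A → fracPow p ((p * (p * (p * 1))) ^ n * A) (3 * suc n) ≡ fracPow p A 3
  fracPow-lift n A =
    trans (cong (fracPow p ((p * (p * (p * 1))) ^ n * A)) (trans (*-suc 3 n) (+-comm 3 (3 * n)))) (fracPow-p³ⁿ p n A 3)

  regular-at-0 : ∀ n x → x % p ≡ 0 → fracPow p ((p * (p * (p * 1))) ^ n * G (residue p 1 x)) (3 * suc n) ≡ γ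
  regular-at-0 n x x%p≡0 =
    trans (fracPow-lift n _) (trans (cong (λ r → fracPow p (G r) 3) (trans (residue-1 p x) x%p≡0)) γ≡)

  ratio-unit : ∀ u → u % p ≢ 0 → ∀ n → ratio p u (n + 1) ≡ fracPow p (G (u % p)) 3
  ratio-unit u u≢0 n =
    trans (cong (λ v → ratio p u v) (+-comm n 1))
    (trans (ratio≡ (suc n) u)
    (trans (cong (λ A → fracPow p A (3 * suc n)) (solutions-unit n u u≢0))
    (trans (fracPow-lift n (G (residue p 1 u)))
           (cong (λ r → fracPow p (G r) 3) (residue-1 p u)))))

  ratio-p² : ∀ v M → ratio p (p * p * M) (suc (suc v)) ≡ γ ℚ.+ inv p 2 ℚ.* ratio p M v
  ratio-p² v M =
    trans (ratio≡ (suc (suc v)) (p * p * M))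
    (trans (cong (λ A → fracPow p A (3 * suc (suc v))) (solutions-p² v M))
    (trans (fracPow-+ p ((p * (p * (p * 1))) ^ suc v * G (residue p 1 (p * p * M)))
                        (p ^ 4 * solutions^ p v (residue p v M) always F) (3 * suc (suc v)))
           (cong₂ ℚ._+_ (regular-at-0 (suc v) (p * p * M) (p∣⇒%≡0 p _ (∣m⇒∣m*n M (m∣m*n p))))
                        (trans (fracPow-p⁴ p (solutions^ p v (residue p v M) always F) v) (cong (inv p 2 ℚ.*_) (sym (ratio≡ v M)))))))

  ratio-p*unit : ∀ u → u % p ≢ 0 → ∀ n → ratio p (p * u) (n + 2) ≡ γ ℚ.+ fracPow p (p * G′ (u % p)) 6
  ratio-p*unit u u≢0 n =
    trans (cong (λ v → ratio p (p * u) v) (+-comm n 2))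
    (trans (ratio≡ (suc (suc n)) (p * u))
    (trans (cong (λ A → fracPow p A (3 * suc (suc n))) (solutions-p-unit n u u≢0))
    (trans (fracPow-+ p ((p * (p * (p * 1))) ^ suc n * G (residue p 1 (p * u)))
                        (p * (X * G′ (residue p 1 u))) (3 * suc (suc n)))
           (cong₂ ℚ._+_ (regular-at-0 (suc n) (p * u) (p∣⇒%≡0 p _ (m∣m*n u))) lower))))
    where
    X = (p * (p * (p * 1))) ^ n
    lower : fracPow p (p * (X * G′ (residue p 1 u))) (3 * suc (suc n)) ≡ fracPow p (p * G′ (u % p)) 6
    lower = trans (cong₂ (fracPow p) (solve 3 (λ p X A → p :* (X :* A) := X :* (p :* A)) refl p X (G′ (residue p 1 u)))
                                     (solve 1 (λ n → con 3 :* (con 2 :+ n) := con 3 :* n :+ con 6) refl n))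
            (trans (fracPow-p³ⁿ p n (p * G′ (residue p 1 u)) 6)
                   (cong (λ r → fracPow p (p * G′ r) 6) (residue-1 p u)))

  density-even : ∀ c (P : ℕ → Set) → (∀ r → P r → fracPow p (G r) 3 ≡ evenOrderDensity p γ c 0) →
    ∀ m k u → m ≡ p ^ (2 * k) * u → ¬ (p ∣ u) → P (u % p) → IsLocalDensity p m (evenOrderDensity p γ c k)
  density-even c P at-units m k u refl p∤u Pu =
    density-p^2k p γ (evenOrderDensity p γ c) 0 1 u z≤n (λ k → evenOrderDensity-suc p γ c k) (λ v M _ → ratio-p² v M)
      (λ n → trans (ratio-unit u (∤⇒%≢0 p u p∤u) n) (at-units (u % p) Pu)) k

  density-odd : ∀ (L : ℕ → ℚ) (P : ℕ → Set) → (∀ k → L (suc k) ≡ γ ℚ.+ inv p 2 ℚ.* L k) →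
    (∀ r → P r → γ ℚ.+ fracPow p (p * G′ r) 6 ≡ L 0) →
    ∀ m k u → m ≡ p ^ (2 * k + 1) * u → ¬ (p ∣ u) → P (u % p) → IsLocalDensity p m (L k)
  density-odd L P L-suc at-units m k u refl p∤u Pu =
    subst (λ m → IsLocalDensity p m (L k)) (sym (^-2k+1 p k u))
      (density-p^2k p γ L 0 2 (p * u) z≤n L-suc (λ v M _ → ratio-p² v M)
        (λ n → trans (ratio-p*unit u (∤⇒%≢0 p u p∤u) n) (at-units (u % p) Pu)) k)

Σ4-swap-yz : ∀ N (f : Fun4) → Σ4 N f ≡ Σ4 N (λ x y z w → f x z y w)
Σ4-swap-yz N f = sumBelow-cong N λ x _ → sumBelow-swap N N _

Σ4-swap-zw : ∀ N (f : Fun4) → Σ4 N f ≡ Σ4 N (λ x y z w → f x y w z)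
Σ4-swap-zw N f = sumBelow-cong N λ x _ → sumBelow-cong N λ y _ → sumBelow-swap N N _

Σ4-as-solutions : ∀ N r (H F : Fun4) .{{_ : NonZero N}} → (∀ x y z w → H x y z w ≡ F x y z w) →
  Σ4 N (λ x y z w → ind (H x y z w % N ≡ᵇ r)) ≡ solutions N r always F
Σ4-as-solutions N r H F H≡F =
  Σ4-cong N λ x y z w _ _ _ _ → trans (cong (λ a → ind (a % N ≡ᵇ r)) (H≡F x y z w)) (sym (+-identityʳ _))

count≡solutions-2 : ∀ v m → count (2 ^ v) m {{m^n≢0 2 v}} ≡ solutions^ 2 v (residue 2 v m) always (diag 1 7 (1 * 2) 13)
count≡solutions-2 v m =
  trans (Σ4-swap-yz (2 ^ v) _)
        (Σ4-as-solutions (2 ^ v) (residue 2 v m) (λ x y z w → Q x z y w) (diag 1 7 (1 * 2) 13) {{m^n≢0 2 v}}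
          (solve 4 (λ x y z w → x :* x :+ con 2 :* (z :* z) :+ con 7 :* (y :* y) :+ con 13 :* (w :* w)
                              := con 1 :* (x :* x) :+ con 7 :* (y :* y) :+ con 2 :* (z :* z) :+ con 13 :* (w :* w)) refl))

count≡solutions-7 : ∀ v m → count (7 ^ v) m {{m^n≢0 7 v}} ≡ solutions^ 7 v (residue 7 v m) always (diag 1 2 (1 * 7) 13)
count≡solutions-7 v m =
  Σ4-as-solutions (7 ^ v) (residue 7 v m) Q (diag 1 2 (1 * 7) 13) {{m^n≢0 7 v}}
    (solve 4 (λ x y z w → x :* x :+ con 2 :* (y :* y) :+ con 7 :* (z :* z) :+ con 13 :* (w :* w)
                        := con 1 :* (x :* x) :+ con 2 :* (y :* y) :+ con 7 :* (z :* z) :+ con 13 :* (w :* w)) refl)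

count≡solutions-13 : ∀ v m → count (13 ^ v) m {{m^n≢0 13 v}} ≡ solutions^ 13 v (residue 13 v m) always (diag 1 2 (1 * 13) 7)
count≡solutions-13 v m =
  trans (Σ4-swap-zw (13 ^ v) _)
        (Σ4-as-solutions (13 ^ v) (residue 13 v m) (λ x y z w → Q x y w z) (diag 1 2 (1 * 13) 7) {{m^n≢0 13 v}}
          (solve 4 (λ x y z w → x :* x :+ con 2 :* (y :* y) :+ con 7 :* (w :* w) :+ con 13 :* (z :* z)
                              := con 1 :* (x :* x) :+ con 2 :* (y :* y) :+ con 13 :* (z :* z) :+ con 7 :* (w :* w)) refl))

module TwoAdicDensity where

  open TwoAdicCounts

  γ : ℚ
  γ = + 3 / 4

  -- Opaque, so that Agda does not expand these sums of 4096 terms when comparing types.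
  opaque
    G : ℕ → ℕ
    G r = solutions^ 2 3 r (regular 2) F

    G′ : ℕ → ℕ
    G′ r = solutions^ 2 3 r (z-regular 2) F′

  opaque
    unfolding G G′

    G-unfold : ∀ r → solutions^ 2 3 r (regular 2) F ≡ G r
    G-unfold r = refl

    G′-unfold : ∀ r → solutions^ 2 3 r (z-regular 2) F′ ≡ G′ r
    G′-unfold r = refl

    regular-at-0 : fracPow 2 (G 0) 9 ≡ γ
    regular-at-0 = refl

    regular-at-4 : fracPow 2 (G 4) 9 ≡ γ
    regular-at-4 = refl

  ratio≡ : ∀ v m → ratio 2 m v ≡ fracPow 2 (solutions^ 2 v (residue 2 v m) always F) (3 * v)
  ratio≡ v m = cong (λ A → fracPow 2 A (3 * v)) (count≡solutions-2 v m)

  fracPow-lift : ∀ n A → fracPow 2 (8 ^ n * A) (3 * (3 + n)) ≡ fracPow 2 A 9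
  fracPow-lift n A =
    trans (cong (fracPow 2 (8 ^ n * A)) (solve 1 (λ n → con 3 :* (con 3 :+ n) := con 3 :* n :+ con 9) refl n))
          (fracPow-p³ⁿ 2 n A 9)

  4M%8 : ∀ M → (2 * 2 * M) % 8 ≡ 0 ⊎ (2 * 2 * M) % 8 ≡ 4
  4M%8 M with M % 2 | m%n<n M 2 | m%n*o≡m*o%[n*o] M 2 4
  ... | 0 | _ | e = inj₁ (trans (cong (_% 8) (*-comm 4 M)) (sym e))
  ... | 1 | _ | e = inj₂ (trans (cong (_% 8) (*-comm 4 M)) (sym e))
  ... | suc (suc _) | s≤s (s≤s ()) | _

  regular-at-4M : ∀ M → fracPow 2 (G ((2 * 2 * M) % 8)) 9 ≡ γ
  regular-at-4M M with 4M%8 M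
  ... | inj₁ e = trans (cong (λ r → fracPow 2 (G r) 9) e) regular-at-0
  ... | inj₂ e = trans (cong (λ r → fracPow 2 (G r) 9) e) regular-at-4

  ratio-unit : ∀ u → u % 2 ≢ 0 → ∀ n → ratio 2 u (n + 3) ≡ fracPow 2 (G (u % 8)) 9
  ratio-unit u u≢0 n =
    trans (cong (λ v → ratio 2 u v) (+-comm n 3))
    (trans (ratio≡ (3 + n) u)
    (trans (cong (λ A → fracPow 2 A (3 * (3 + n))) (trans (solutions-unit n u u≢0) (cong (8 ^ n *_) (G-unfold (u % 8)))))
           (fracPow-lift n (G (u % 8)))))

  ratio-4 : ∀ v M → 1 ≤ v → ratio 2 (2 * 2 * M) (suc (suc v)) ≡ γ ℚ.+ inv 2 2 ℚ.* ratio 2 M v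
  ratio-4 (suc n) M _ =
    trans (ratio≡ (3 + n) (2 * 2 * M))
    (trans (cong (λ A → fracPow 2 A (3 * (3 + n)))
                 (trans (solutions-4 n M) (cong (λ A → 8 ^ n * A + 16 * C) (G-unfold ((2 * 2 * M) % 8)))))
    (trans (fracPow-+ 2 (8 ^ n * G ((2 * 2 * M) % 8)) (16 * C) (3 * (3 + n)))
           (cong₂ ℚ._+_ (trans (fracPow-lift n _) (regular-at-4M M))
                        (trans (fracPow-p⁴ 2 C (suc n)) (cong (inv 2 2 ℚ.*_) (sym (ratio≡ (suc n) M)))))))
    where C = solutions^ 2 (1 + n) (residue 2 (1 + n) M) always F

  ratio-2*unit : ∀ u → u % 2 ≢ 0 → ∀ n →
    ratio 2 (2 * u) (n + 4) ≡ fracPow 2 (G ((2 * (u % 8)) % 8)) 9 ℚ.+ fracPow 2 (2 * G′ (u % 8)) 12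
  ratio-2*unit u u≢0 n =
    trans (cong (λ v → ratio 2 (2 * u) v) (+-comm n 4))
    (trans (ratio≡ (4 + n) (2 * u))
    (trans (cong (λ A → fracPow 2 A (3 * (4 + n)))
                 (trans (solutions-2-unit n u u≢0)
                        (cong₂ (λ A B → 8 ^ suc n * A + 2 * (8 ^ n * B)) (G-unfold ((2 * u) % 8)) (G′-unfold (u % 8)))))
    (trans (fracPow-+ 2 (8 ^ suc n * G ((2 * u) % 8)) (2 * (8 ^ n * G′ (u % 8))) (3 * (4 + n)))
           (cong₂ ℚ._+_ (trans (fracPow-lift (suc n) _) (cong (λ r → fracPow 2 (G r) 9) 2u%8))
                        lower))))
    where
    2u%8 : (2 * u) % 8 ≡ (2 * (u % 8)) % 8
    2u%8 = *-%-compatible 8 2 u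
    lower : fracPow 2 (2 * (8 ^ n * G′ (u % 8))) (3 * (4 + n)) ≡ fracPow 2 (2 * G′ (u % 8)) 12
    lower = trans (cong₂ (fracPow 2) (solve 2 (λ X A → con 2 :* (X :* A) := X :* (con 2 :* A)) refl (8 ^ n) (G′ (u % 8)))
                                     (solve 1 (λ n → con 3 :* (con 4 :+ n) := con 3 :* n :+ con 12) refl n))
                  (fracPow-p³ⁿ 2 n (2 * G′ (u % 8)) 12)

  density-even : ∀ c (P : ℕ → Set) → (∀ r → P r → fracPow 2 (G r) 9 ≡ evenOrderDensity 2 γ c 0) →
    ∀ m k u → m ≡ 2 ^ (2 * k) * u → ¬ (2 ∣ u) → P (u % 8) → IsLocalDensity 2 m (evenOrderDensity 2 γ c k)
  density-even c P at-units m k u refl 2∤u Pu =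
    density-p^2k 2 γ (evenOrderDensity 2 γ c) 1 3 u (s≤s z≤n) (λ k → evenOrderDensity-suc 2 γ c k) ratio-4
      (λ n → trans (ratio-unit u (∤⇒%≢0 2 u 2∤u) n) (at-units (u % 8) Pu)) k

  density-odd : ∀ c (P : ℕ → Set) →
    (∀ r → P r → fracPow 2 (G ((2 * r) % 8)) 9 ℚ.+ fracPow 2 (2 * G′ r) 12 ≡ oddOrderDensity 2 γ c 0) →
    ∀ m k u → m ≡ 2 ^ (2 * k + 1) * u → ¬ (2 ∣ u) → P (u % 8) → IsLocalDensity 2 m (oddOrderDensity 2 γ c k)
  density-odd c P at-units m k u refl 2∤u Pu =
    subst (λ m → IsLocalDensity 2 m (oddOrderDensity 2 γ c k)) (sym (^-2k+1 2 k u))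
      (density-p^2k 2 γ (oddOrderDensity 2 γ c) 1 4 (2 * u) (s≤s z≤n) (λ k → oddOrderDensity-suc 2 γ c k) ratio-4
        (λ n → trans (ratio-2*unit u (∤⇒%≢0 2 u 2∤u) n) (at-units (u % 8) Pu)) k)

module β₇ = OddPrimeDensity 7 1 2 1 13 tt tt tt tt tt tt count≡solutions-7 (+ 48 / 49) refl

module β₁₃ = OddPrimeDensity 13 1 2 1 7 tt tt tt tt tt tt count≡solutions-13 (+ 168 / 169) refl

module β₂ = TwoAdicDensity

opaque
  unfolding β₂.G β₂.G′

  β₂-even-1,3 : ∀ r → r ≡ 1 ⊎ r ≡ 3 → fracPow 2 (β₂.G r) 9 ≡ evenOrderDensity 2 β₂.γ (+ 3 / 4) 0
  β₂-even-1,3 _ (inj₁ refl) = refl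
  β₂-even-1,3 _ (inj₂ refl) = refl

  β₂-even-5,7 : ∀ r → r ≡ 5 ⊎ r ≡ 7 → fracPow 2 (β₂.G r) 9 ≡ evenOrderDensity 2 β₂.γ (+ 5 / 4) 0
  β₂-even-5,7 _ (inj₁ refl) = refl
  β₂-even-5,7 _ (inj₂ refl) = refl

  β₂-odd-1,3 : ∀ r → r ≡ 1 ⊎ r ≡ 3 →
    fracPow 2 (β₂.G ((2 * r) % 8)) 9 ℚ.+ fracPow 2 (2 * β₂.G′ r) 12 ≡ oddOrderDensity 2 β₂.γ (+ 3 / 4) 0
  β₂-odd-1,3 _ (inj₁ refl) = refl
  β₂-odd-1,3 _ (inj₂ refl) = refl

  β₂-odd-5,7 : ∀ r → r ≡ 5 ⊎ r ≡ 7 →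
    fracPow 2 (β₂.G ((2 * r) % 8)) 9 ℚ.+ fracPow 2 (2 * β₂.G′ r) 12 ≡ oddOrderDensity 2 β₂.γ (+ 1 / 4) 0
  β₂-odd-5,7 _ (inj₁ refl) = refl
  β₂-odd-5,7 _ (inj₂ refl) = refl

β₇-even-residue : ∀ r → r ≡ 1 ⊎ r ≡ 2 ⊎ r ≡ 4 → fracPow 7 (β₇.G r) 3 ≡ evenOrderDensity 7 (+ 48 / 49) (+ 8 / 7) 0
β₇-even-residue _ (inj₁ refl)        = refl
β₇-even-residue _ (inj₂ (inj₁ refl)) = refl
β₇-even-residue _ (inj₂ (inj₂ refl)) = refl

β₇-even-nonresidue : ∀ r → r ≡ 3 ⊎ r ≡ 5 ⊎ r ≡ 6 → fracPow 7 (β₇.G r) 3 ≡ evenOrderDensity 7 (+ 48 / 49) (+ 6 / 7) 0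
β₇-even-nonresidue _ (inj₁ refl)        = refl
β₇-even-nonresidue _ (inj₂ (inj₁ refl)) = refl
β₇-even-nonresidue _ (inj₂ (inj₂ refl)) = refl

β₇-odd-residue : ∀ r → r ≡ 1 ⊎ r ≡ 2 ⊎ r ≡ 4 →
  + 48 / 49 ℚ.+ fracPow 7 (7 * β₇.G′ r) 6 ≡ oddOrderDensity 7 (+ 48 / 49) (+ 2 / 7) 0
β₇-odd-residue _ (inj₁ refl)        = refl
β₇-odd-residue _ (inj₂ (inj₁ refl)) = refl
β₇-odd-residue _ (inj₂ (inj₂ refl)) = refl

β₇-odd-nonresidue : ∀ r → r ≡ 3 ⊎ r ≡ 5 ⊎ r ≡ 6 →
  + 48 / 49 ℚ.+ fracPow 7 (7 * β₇.G′ r) 6 ≡ oddOrderDensity₀ 7 (+ 48 / 49) 0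
β₇-odd-nonresidue _ (inj₁ refl)        = refl
β₇-odd-nonresidue _ (inj₂ (inj₁ refl)) = refl
β₇-odd-nonresidue _ (inj₂ (inj₂ refl)) = refl

β₁₃-even-residue : ∀ r → r ≡ 1 ⊎ r ≡ 3 ⊎ r ≡ 4 ⊎ r ≡ 9 ⊎ r ≡ 10 ⊎ r ≡ 12 →
  fracPow 13 (β₁₃.G r) 3 ≡ evenOrderDensity 13 (+ 168 / 169) (+ 14 / 13) 0
β₁₃-even-residue _ (inj₁ refl)                             = refl
β₁₃-even-residue _ (inj₂ (inj₁ refl))                      = refl
β₁₃-even-residue _ (inj₂ (inj₂ (inj₁ refl)))               = refl
β₁₃-even-residue _ (inj₂ (inj₂ (inj₂ (inj₁ refl))))        = refl
β₁₃-even-residue _ (inj₂ (inj₂ (inj₂ (inj₂ (inj₁ refl))))) = refl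
β₁₃-even-residue _ (inj₂ (inj₂ (inj₂ (inj₂ (inj₂ refl))))) = refl

β₁₃-even-nonresidue : ∀ r → r ≡ 2 ⊎ r ≡ 5 ⊎ r ≡ 6 ⊎ r ≡ 7 ⊎ r ≡ 8 ⊎ r ≡ 11 →
  fracPow 13 (β₁₃.G r) 3 ≡ evenOrderDensity 13 (+ 168 / 169) (+ 12 / 13) 0
β₁₃-even-nonresidue _ (inj₁ refl)                             = refl
β₁₃-even-nonresidue _ (inj₂ (inj₁ refl))                      = refl
β₁₃-even-nonresidue _ (inj₂ (inj₂ (inj₁ refl)))               = refl
β₁₃-even-nonresidue _ (inj₂ (inj₂ (inj₂ (inj₁ refl))))        = refl
β₁₃-even-nonresidue _ (inj₂ (inj₂ (inj₂ (inj₂ (inj₁ refl))))) = refl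
β₁₃-even-nonresidue _ (inj₂ (inj₂ (inj₂ (inj₂ (inj₂ refl))))) = refl

β₁₃-odd-residue : ∀ r → r ≡ 1 ⊎ r ≡ 3 ⊎ r ≡ 4 ⊎ r ≡ 9 ⊎ r ≡ 10 ⊎ r ≡ 12 →
  + 168 / 169 ℚ.+ fracPow 13 (13 * β₁₃.G′ r) 6 ≡ oddOrderDensity 13 (+ 168 / 169) (+ 2 / 13) 0
β₁₃-odd-residue _ (inj₁ refl)                             = refl
β₁₃-odd-residue _ (inj₂ (inj₁ refl))                      = refl
β₁₃-odd-residue _ (inj₂ (inj₂ (inj₁ refl)))               = refl
β₁₃-odd-residue _ (inj₂ (inj₂ (inj₂ (inj₁ refl))))        = refl
β₁₃-odd-residue _ (inj₂ (inj₂ (inj₂ (inj₂ (inj₁ refl))))) = refl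
β₁₃-odd-residue _ (inj₂ (inj₂ (inj₂ (inj₂ (inj₂ refl))))) = refl

β₁₃-odd-nonresidue : ∀ r → r ≡ 2 ⊎ r ≡ 5 ⊎ r ≡ 6 ⊎ r ≡ 7 ⊎ r ≡ 8 ⊎ r ≡ 11 →
  + 168 / 169 ℚ.+ fracPow 13 (13 * β₁₃.G′ r) 6 ≡ oddOrderDensity₀ 13 (+ 168 / 169) 0
β₁₃-odd-nonresidue _ (inj₁ refl)                             = refl
β₁₃-odd-nonresidue _ (inj₂ (inj₁ refl))                      = refl
β₁₃-odd-nonresidue _ (inj₂ (inj₂ (inj₁ refl)))               = refl
β₁₃-odd-nonresidue _ (inj₂ (inj₂ (inj₂ (inj₁ refl))))        = refl
β₁₃-odd-nonresidue _ (inj₂ (inj₂ (inj₂ (inj₂ (inj₁ refl))))) = refl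
β₁₃-odd-nonresidue _ (inj₂ (inj₂ (inj₂ (inj₂ (inj₂ refl))))) = refl

lemma14 : (m : ℕ) → 0 < m → (k : ℕ) →
  ((∀ u → m ≡ 2 ^ (2 * k) * u → ¬ (2 ∣ u) → (u % 8 ≡ 1 ⊎ u % 8 ≡ 3) →
      IsLocalDensity 2 m ((+ 3 / 4) ℚ.* geom 2 k ℚ.+ inv 2 (2 * k) ℚ.* (+ 3 / 4)))
  × (∀ u → m ≡ 2 ^ (2 * k) * u → ¬ (2 ∣ u) → (u % 8 ≡ 5 ⊎ u % 8 ≡ 7) →
      IsLocalDensity 2 m ((+ 3 / 4) ℚ.* geom 2 k ℚ.+ inv 2 (2 * k) ℚ.* (+ 5 / 4)))
  × (∀ u → m ≡ 2 ^ (2 * k + 1) * u → ¬ (2 ∣ u) → (u % 8 ≡ 1 ⊎ u % 8 ≡ 3) →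
      IsLocalDensity 2 m ((+ 3 / 4) ℚ.* geom 2 (suc k) ℚ.+ inv 2 (2 * k + 1) ℚ.* (+ 3 / 4)))
  × (∀ u → m ≡ 2 ^ (2 * k + 1) * u → ¬ (2 ∣ u) → (u % 8 ≡ 5 ⊎ u % 8 ≡ 7) →
      IsLocalDensity 2 m ((+ 3 / 4) ℚ.* geom 2 (suc k) ℚ.+ inv 2 (2 * k + 1) ℚ.* (+ 1 / 4))))
  × ((∀ u → m ≡ 7 ^ (2 * k) * u → ¬ (7 ∣ u) → (u % 7 ≡ 1 ⊎ u % 7 ≡ 2 ⊎ u % 7 ≡ 4) →
      IsLocalDensity 7 m ((+ 48 / 49) ℚ.* geom 7 k ℚ.+ inv 7 (2 * k) ℚ.* (+ 8 / 7)))
  × (∀ u → m ≡ 7 ^ (2 * k) * u → ¬ (7 ∣ u) → (u % 7 ≡ 3 ⊎ u % 7 ≡ 5 ⊎ u % 7 ≡ 6) →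
      IsLocalDensity 7 m ((+ 48 / 49) ℚ.* geom 7 k ℚ.+ inv 7 (2 * k) ℚ.* (+ 6 / 7)))
  × (∀ u → m ≡ 7 ^ (2 * k + 1) * u → ¬ (7 ∣ u) → (u % 7 ≡ 1 ⊎ u % 7 ≡ 2 ⊎ u % 7 ≡ 4) →
      IsLocalDensity 7 m ((+ 48 / 49) ℚ.* geom 7 (suc k) ℚ.+ inv 7 (2 * k + 1) ℚ.* (+ 2 / 7)))
  × (∀ u → m ≡ 7 ^ (2 * k + 1) * u → ¬ (7 ∣ u) → (u % 7 ≡ 3 ⊎ u % 7 ≡ 5 ⊎ u % 7 ≡ 6) →
      IsLocalDensity 7 m ((+ 48 / 49) ℚ.* geom 7 (suc k))))
  × ((∀ u → m ≡ 13 ^ (2 * k) * u → ¬ (13 ∣ u) →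
        (u % 13 ≡ 1 ⊎ u % 13 ≡ 3 ⊎ u % 13 ≡ 4 ⊎ u % 13 ≡ 9 ⊎ u % 13 ≡ 10 ⊎ u % 13 ≡ 12) →
      IsLocalDensity 13 m ((+ 168 / 169) ℚ.* geom 13 k ℚ.+ inv 13 (2 * k) ℚ.* (+ 14 / 13)))
  × (∀ u → m ≡ 13 ^ (2 * k) * u → ¬ (13 ∣ u) →
        (u % 13 ≡ 2 ⊎ u % 13 ≡ 5 ⊎ u % 13 ≡ 6 ⊎ u % 13 ≡ 7 ⊎ u % 13 ≡ 8 ⊎ u % 13 ≡ 11) →
      IsLocalDensity 13 m ((+ 168 / 169) ℚ.* geom 13 k ℚ.+ inv 13 (2 * k) ℚ.* (+ 12 / 13)))
  × (∀ u → m ≡ 13 ^ (2 * k + 1) * u → ¬ (13 ∣ u) →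
        (u % 13 ≡ 1 ⊎ u % 13 ≡ 3 ⊎ u % 13 ≡ 4 ⊎ u % 13 ≡ 9 ⊎ u % 13 ≡ 10 ⊎ u % 13 ≡ 12) →
      IsLocalDensity 13 m ((+ 168 / 169) ℚ.* geom 13 (suc k) ℚ.+ inv 13 (2 * k + 1) ℚ.* (+ 2 / 13)))
  × (∀ u → m ≡ 13 ^ (2 * k + 1) * u → ¬ (13 ∣ u) →
        (u % 13 ≡ 2 ⊎ u % 13 ≡ 5 ⊎ u % 13 ≡ 6 ⊎ u % 13 ≡ 7 ⊎ u % 13 ≡ 8 ⊎ u % 13 ≡ 11) →
      IsLocalDensity 13 m ((+ 168 / 169) ℚ.* geom 13 (suc k))))
lemma14 m _ k =
  ( β₂.density-even (+ 3 / 4) _ β₂-even-1,3 m k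
  , β₂.density-even (+ 5 / 4) _ β₂-even-5,7 m k
  , β₂.density-odd (+ 3 / 4) _ β₂-odd-1,3 m k
  , β₂.density-odd (+ 1 / 4) _ β₂-odd-5,7 m k )
  , ( β₇.density-even (+ 8 / 7) _ β₇-even-residue m k
  , β₇.density-even (+ 6 / 7) _ β₇-even-nonresidue m k
  , β₇.density-odd (oddOrderDensity 7 (+ 48 / 49) (+ 2 / 7)) _ (λ j → oddOrderDensity-suc 7 (+ 48 / 49) (+ 2 / 7) j) β₇-odd-residue m k
  , β₇.density-odd (oddOrderDensity₀ 7 (+ 48 / 49)) _ (λ j → oddOrderDensity₀-suc 7 (+ 48 / 49) j) β₇-odd-nonresidue m k )
  , ( β₁₃.density-even (+ 14 / 13) _ β₁₃-even-residue m k
  , β₁₃.density-even (+ 12 / 13) _ β₁₃-even-nonresidue m k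
  , β₁₃.density-odd (oddOrderDensity 13 (+ 168 / 169) (+ 2 / 13)) _ (λ j → oddOrderDensity-suc 13 (+ 168 / 169) (+ 2 / 13) j) β₁₃-odd-residue m k
  , β₁₃.density-odd (oddOrderDensity₀ 13 (+ 168 / 169)) _ (λ j → oddOrderDensity₀-suc 13 (+ 168 / 169) j) β₁₃-odd-nonresidue m k )
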